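{- Let $p$ be a prime, let $0\ne E\in F_p[x,y]$, let $d=\deg_yE$, and let $f=\sum_{n\ge0}f_nx^n$ and $g=\sum_{n\ge0}g_nx^n$ be power series in $F_p[[x]]$ with $f\ne g$ and $E(x,f(x))=E(x,g(x))=0$. Then $f_n\ne g_n$ for some $n\le (d+1)(p^d-d+1)\deg_xE$.
   Context: $F_p=\mathbb{Z}/p\mathbb{Z}$ is the field with $p$ elements and $F_p[[x]]$ the ring of formal power series over it. $\deg_yE$ is the degree of $E$ as a polynomial in $y$ with coefficients in $F_p[x]$, and $\deg_xE$ is the degree of $E$ as a polynomial in $x$ with coefficients in $F_p[y]$. -}

module Defs where

open import Data.Nat using (ℕ; zero; suc; _+_; _*_; _∸_; _<_)
open import Data.Fin using (Fin; toℕ)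
open import Data.List using (List; []; _∷_; map; upTo)
open import Data.Nat.ListAction using (sum)
open import Data.Nat.Divisibility using (_∣_)
open import Data.Product using (∃; ∃-syntax; _×_)
open import Relation.Binary.PropositionalEquality using (_≡_; _≢_)

-- A polynomial E ∈ F_p[x,y] is written E = Σ_j E_j(x) y^j, given as the list
-- [E_0, E_1, …] of its y-coefficients, each E_j ∈ F_p[x] given as the list of
-- its x-coefficients [e_0j, e_1j, …] (elements of F_p = Fin p).
-- Trailing zeros are allowed; all notions below depend only on the coefficients.
Poly2 : ℕ → Set
Poly2 p = List (List (Fin p))

lookupD : ∀ {p} → List (Fin p) → ℕ → ℕ
lookupD []       _       = 0
lookupD (a ∷ as) zero    = toℕ a
lookupD (a ∷ as) (suc i) = lookupD as i

-- coeff E i j = (coefficient of x^i y^j in E), as a natural number < p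
coeff : ∀ {p} → Poly2 p → ℕ → ℕ → ℕ
coeff []       i j       = 0
coeff (r ∷ rs) i zero    = lookupD r i
coeff (r ∷ rs) i (suc j) = coeff rs i j

NonZeroPoly : ∀ {p} → Poly2 p → Set
NonZeroPoly E = ∃[ i ] ∃[ j ] coeff E i j ≢ 0

DegY : ∀ {p} → Poly2 p → ℕ → Set
DegY E d = (∃[ i ] coeff E i d ≢ 0) × (∀ i j → d < j → coeff E i j ≡ 0)

DegX : ∀ {p} → Poly2 p → ℕ → Set
DegX E m = (∃[ j ] coeff E m j ≢ 0) × (∀ i j → m < i → coeff E i j ≡ 0)

-- Power series with natural-number coefficients; arithmetic is done in ℕ and
-- reduced mod p at the end (reduction mod p is a ring homomorphism ℕ → F_p).
Series : Set
Series = ℕ → ℕ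

addS : Series → Series → Series
addS a b n = a n + b n

mulS : Series → Series → Series
mulS a b n = sum (map (λ k → a k * b (n ∸ k)) (upTo (suc n)))

zeroS : Series
zeroS _ = 0

liftS : ∀ {p} → (ℕ → Fin p) → Series
liftS f n = toℕ (f n)

evalS : ∀ {p} → Poly2 p → Series → Series
evalS []       F = zeroS
evalS (r ∷ rs) F = addS (lookupD r) (mulS F (evalS rs F))

IsRoot : ∀ {p} → Poly2 p → (ℕ → Fin p) → Set
IsRoot {p} E f = ∀ n → p ∣ evalS E (liftS f) n

-- Let h = f − g and suppose ord h = n > D := (p^d − d + 1)·m. Consider pairs (c, Q) with
-- c_0, …, c_d ∈ F_p[x] of degree ≤ D and Q ∈ F_p[x,y] with deg_y Q ≤ p^d − d, deg_x Q ≤ (p^d − d)·m.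
-- Then T = Σ_i c_i y^{p^i} − E·Q has deg_y T ≤ p^d and deg_x T ≤ D, and there are more pairs than
-- such T, so two different pairs give the same T. Evaluating at the roots f and g kills E·Q, so the
-- two linearized polynomials agree at f and at g, hence at h because y ↦ y^{p^i} is additive in
-- characteristic p. Since the terms c_i h^{p^i} start at the distinct x-degrees p^i·n and n > D,
-- this forces c = c', and then E·Q = E·Q' forces Q = Q'.
module Submission where

open import Algebra.Bundles using (CommutativeSemiring)

module PrimeBinomial where

  open import Data.Nat
  open import Data.Nat.Properties
  open import Data.Nat.Divisibility using (_∣_; ∣⇒≤; m∣m*n)
  open import Data.Nat.Primality using (Prime; euclidsLemma; prime⇒nonTrivial)
  open import Data.Nat.Combinatorics using (_C_; nCk≡n!/k![n-k]!; k![n∸k]!∣n!)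
  open import Data.Nat.DivMod using (m/n*n≡m)
  open import Data.Sum using (inj₁; inj₂)
  open import Relation.Nullary using (¬_; contradiction)
  open import Relation.Binary.PropositionalEquality

  prime>1 : ∀ {p} → Prime p → 1 < p
  prime>1 {p} pp = nonTrivial⇒n>1 p {{prime⇒nonTrivial pp}}

  prime∤! : ∀ {p} → Prime p → ∀ m → m < p → ¬ (p ∣ m !)
  prime∤! pp zero    m<p p∣1    = contradiction (∣⇒≤ p∣1) (<⇒≱ (prime>1 pp))
  prime∤! pp (suc m) m<p p∣m+1! with euclidsLemma (suc m) (m !) pp p∣m+1!
  ... | inj₁ p∣m+1 = contradiction (∣⇒≤ p∣m+1) (<⇒≱ m<p)
  ... | inj₂ p∣m!  = prime∤! pp m (<-trans (n<1+n m) m<p) p∣m!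

  n∣n! : ∀ n → .{{NonZero n}} → n ∣ n !
  n∣n! (suc n) = m∣m*n (n !)

  -- p divides p! = (p C k) · k! · (p − k)! but neither factorial.
  prime∣C : ∀ {p k} → Prime p → 0 < k → k < p → p ∣ p C k
  prime∣C {p} {k} pp 0<k k<p with euclidsLemma (p C k) (k ! * (p ∸ k) !) pp p∣product
    where
    instance _ = k !* (p ∸ k) !≢0
    p!≡product : (p C k) * (k ! * (p ∸ k) !) ≡ p !
    p!≡product = trans (cong (_* (k ! * (p ∸ k) !)) (nCk≡n!/k![n-k]! (<⇒≤ k<p))) (m/n*n≡m (k![n∸k]!∣n! (<⇒≤ k<p)))
    p∣product : p ∣ (p C k) * (k ! * (p ∸ k) !)
    p∣product = subst (p ∣_) (sym p!≡product) (n∣n! p {{>-nonZero (<-trans z<s (prime>1 pp))}})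
  ... | inj₁ p∣C = p∣C
  ... | inj₂ p∣k![p-k]! with euclidsLemma (k !) ((p ∸ k) !) pp p∣k![p-k]!
  ...   | inj₁ p∣k!     = contradiction p∣k! (prime∤! pp k k<p)
  ...   | inj₂ p∣[p-k]! = contradiction p∣[p-k]! (prime∤! pp (p ∸ k) (∸-monoʳ-< 0<k (<⇒≤ k<p)))

module Frobenius {c ℓ} (S : CommutativeSemiring c ℓ) where

  open import Data.Nat as ℕ using (zero; suc; _∸_; z<s; s<s)
  open import Data.Nat.Properties using (n∸n≡0) renaming (*-comm to ℕ-*-comm)
  open import Data.Nat.Divisibility using (_∣_; divides)
  open import Data.Nat.Primality using (Prime)
  open import Data.Nat.Combinatorics using (_C_; nCn≡1)
  open import Data.Fin using (Fin; toℕ; inject₁; fromℕ) renaming (zero to fzero; suc to fsuc)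
  open import Data.Fin.Properties using (toℕ<n; toℕ-fromℕ; toℕ-inject₁)
  open import Function using (_∘_)
  open import Relation.Nullary using (contradiction)
  import Relation.Binary.PropositionalEquality as ≡
  open CommutativeSemiring S
  open import Algebra.Properties.Semiring.Mult semiring using (×-congʳ; ×-assocˡ; ×-assoc-*) renaming (_×_ to _·_)
  open import Algebra.Properties.Semiring.Exp semiring using (_^_; ^-congˡ; ^-assocʳ)
  open import Algebra.Properties.Monoid.Sum +-monoid using (sum; sum-init-last; sum-cong-≋; sum-replicate-zero)
  import Algebra.Properties.CommutativeSemiring.Binomial S as Binomial
  open import Relation.Binary.Reasoning.Setoid setoid
  open PrimeBinomial using (prime>1; prime∣C)

  [x+y]^[n+1]≈x^[n+1]+y^[n+1] : ∀ n → (∀ k z → 0 ℕ.< k → k ℕ.< suc n → (suc n C k) · z ≈ 0#) →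
    ∀ x y → (x + y) ^ suc n ≈ x ^ suc n + y ^ suc n
  [x+y]^[n+1]≈x^[n+1]+y^[n+1] n inner≈0 x y = begin
    (x + y) ^ suc n                                         ≈⟨ Binomial.theorem (suc n) x y ⟩
    t fzero + sum (t ∘ fsuc)                                ≈⟨ +-congˡ (sum-init-last (t ∘ fsuc)) ⟩
    t fzero + (sum (t ∘ fsuc ∘ inject₁) + t (fsuc (fromℕ n))) ≈⟨ +-congˡ (+-congʳ (trans (sum-cong-≋ middle≈0) (sum-replicate-zero n))) ⟩
    t fzero + (0# + t (fsuc (fromℕ n)))                     ≈⟨ +-comm _ _ ⟩
    (0# + t (fsuc (fromℕ n))) + t fzero                     ≈⟨ +-cong (trans (+-identityˡ _) last≈x^[n+1]) first≈y^[n+1] ⟩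
    x ^ suc n + y ^ suc n                                   ∎
    where
    t : Fin (suc (suc n)) → Carrier
    t = Binomial.binomialTerm x y (suc n)
    first≈y^[n+1] : t fzero ≈ y ^ suc n
    first≈y^[n+1] = trans (+-identityʳ _) (*-identityˡ _)
    last≈x^[n+1] : t (fsuc (fromℕ n)) ≈ x ^ suc n
    last≈x^[n+1] = begin
      (suc n C suc (toℕ (fromℕ n))) · (x ^ suc (toℕ (fromℕ n)) * y ^ (n ∸ toℕ (fromℕ n)))
        ≡⟨ ≡.cong (λ k → (suc n C suc k) · (x ^ suc k * y ^ (n ∸ k))) (toℕ-fromℕ n) ⟩
      (suc n C suc n) · (x ^ suc n * y ^ (n ∸ n))
        ≡⟨ ≡.cong₂ (λ c k → c · (x ^ suc n * y ^ k)) (nCn≡1 (suc n)) (n∸n≡0 n) ⟩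
      1 · (x ^ suc n * 1#)
        ≈⟨ trans (+-identityʳ _) (*-identityʳ _) ⟩
      x ^ suc n ∎
    middle≈0 : ∀ j → t (fsuc (inject₁ j)) ≈ 0#
    middle≈0 j = inner≈0 (suc (toℕ (inject₁ j))) _ z<s (s<s (≡.subst (ℕ._< n) (≡.sym (toℕ-inject₁ j)) (toℕ<n j)))

  p∣n⇒n·z≈0 : ∀ {p n} → p · 1# ≈ 0# → p ∣ n → ∀ z → n · z ≈ 0#
  p∣n⇒n·z≈0 {p} p·1≈0 (divides q ≡.refl) z = begin
    (q ℕ.* p) · z       ≡⟨ ≡.cong (_· z) (ℕ-*-comm q p) ⟩
    (p ℕ.* q) · z       ≈⟨ ×-assocˡ z p q ⟨
    p · (q · z)         ≈⟨ ×-congʳ p (*-identityˡ _) ⟨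
    p · (1# * (q · z))  ≈⟨ ×-assoc-* p 1# (q · z) ⟨
    (p · 1#) * (q · z)  ≈⟨ *-congʳ p·1≈0 ⟩
    0# * (q · z)        ≈⟨ zeroˡ _ ⟩
    0#                  ∎

  [x+y]^p≈x^p+y^p : ∀ {p} → Prime p → p · 1# ≈ 0# → ∀ x y → (x + y) ^ p ≈ x ^ p + y ^ p
  [x+y]^p≈x^p+y^p {zero}  pp = contradiction (prime>1 pp) λ ()
  [x+y]^p≈x^p+y^p {suc n} pp p·1≈0 =
    [x+y]^[n+1]≈x^[n+1]+y^[n+1] n λ k z 0<k k<p → p∣n⇒n·z≈0 p·1≈0 (prime∣C pp 0<k k<p) z

  [x+y]^[p^i]≈x^[p^i]+y^[p^i] : ∀ {p} → Prime p → p · 1# ≈ 0# → ∀ i x y → (x + y) ^ (p ℕ.^ i) ≈ x ^ (p ℕ.^ i) + y ^ (p ℕ.^ i)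
  [x+y]^[p^i]≈x^[p^i]+y^[p^i] pp p·1≈0 zero    x y = trans (*-identityʳ _) (+-cong (sym (*-identityʳ x)) (sym (*-identityʳ y)))
  [x+y]^[p^i]≈x^[p^i]+y^[p^i] {p} pp p·1≈0 (suc i) x y = begin
    (x + y) ^ (p ℕ.^ suc i)                   ≈⟨ ^-[p^i]^p (x + y) ⟨
    ((x + y) ^ (p ℕ.^ i)) ^ p                 ≈⟨ ^-congˡ p ([x+y]^[p^i]≈x^[p^i]+y^[p^i] pp p·1≈0 i x y) ⟩
    (x ^ (p ℕ.^ i) + y ^ (p ℕ.^ i)) ^ p       ≈⟨ [x+y]^p≈x^p+y^p pp p·1≈0 _ _ ⟩
    (x ^ (p ℕ.^ i)) ^ p + (y ^ (p ℕ.^ i)) ^ p ≈⟨ +-cong (^-[p^i]^p x) (^-[p^i]^p y) ⟩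
    x ^ (p ℕ.^ suc i) + y ^ (p ℕ.^ suc i)     ∎
    where
    ^-[p^i]^p : ∀ z → (z ^ (p ℕ.^ i)) ^ p ≈ z ^ (p ℕ.^ suc i)
    ^-[p^i]^p z = trans (^-assocʳ z (p ℕ.^ i) p) (reflexive (≡.cong (z ^_) (ℕ-*-comm (p ℕ.^ i) p)))

open import Defs
open import Data.Nat
open import Data.Nat.Properties
open import Data.Nat.DivMod using (_mod_; %-distribˡ-+; %-distribˡ-*; m*n%n≡0; m<n⇒m%n≡m; m≡m%n+[m/n]*n; [m+n]%n≡m%n; m%n≤n; n%n≡0)
open import Data.Nat.Divisibility using (_∣_; divides; m%n≡0⇒n∣m; n∣m⇒m%n≡0)
open import Data.Nat.Primality using (Prime; euclidsLemma; prime⇒nonZero)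
open import Data.Nat.Tactic.RingSolver using (solve-∀)
open import Data.Nat.Induction using (<-rec)
open import Data.Fin as Fin using (Fin; toℕ; fromℕ<; combine; remQuot; _↑ˡ_; _↑ʳ_; splitAt; funToFin; finToFun)
open import Data.Fin.Properties using (toℕ<n; toℕ-injective; toℕ-fromℕ<; remQuot-combine; combine-remQuot; join-splitAt; pigeonhole; finToFun-funToFin; funToFin-finToFin; all?; ¬∀⟶∃¬)
open import Data.List using (List; []; _∷_; map; applyUpTo; tabulate)
open import Data.Nat.ListAction using (sum)
open import Data.Product using (∃; ∃-syntax; _×_; _,_; proj₁; proj₂)
open import Data.Sum using (inj₁; inj₂)
open import Data.Empty using (⊥; ⊥-elim)
open import Function using (_∘_)
open import Level using (0ℓ)
open import Relation.Nullary using (¬_; yes; no; contradiction)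
open import Relation.Binary.PropositionalEquality
open import Algebra.Structures using (IsCommutativeMonoid)
open import Relation.Binary.Structures using (IsEquivalence)

extend : ∀ {A : Set} {n} → A → (Fin n → A) → ℕ → A
extend {n = zero}  z g k       = z
extend {n = suc n} z g zero    = g Fin.zero
extend {n = suc n} z g (suc k) = extend z (g ∘ Fin.suc) k

extend-toℕ : ∀ {A : Set} {n} (z : A) (g : Fin n → A) i → extend z g (toℕ i) ≡ g i
extend-toℕ z g Fin.zero    = refl
extend-toℕ z g (Fin.suc i) = extend-toℕ z (g ∘ Fin.suc) i

extend-≥ : ∀ {A : Set} {n} (z : A) (g : Fin n → A) k → n ≤ k → extend z g k ≡ z
extend-≥ {n = zero}  z g k       _       = refl
extend-≥ {n = suc n} z g (suc k) n+1≤k+1 = extend-≥ z (g ∘ Fin.suc) k (s≤s⁻¹ n+1≤k+1)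

extend-all : ∀ {A : Set} {n} (P : A → Set) {z : A} {g : Fin n → A} → P z → (∀ i → P (g i)) → ∀ k → P (extend z g k)
extend-all {n = zero}  P Pz Pg k       = Pz
extend-all {n = suc n} P Pz Pg zero    = Pg Fin.zero
extend-all {n = suc n} P Pz Pg (suc k) = extend-all P Pz (Pg ∘ Fin.suc) k

funToFin-cong : ∀ {m n} {f g : Fin m → Fin n} → f ≗ g → funToFin f ≡ funToFin g
funToFin-cong {zero}  f≗g = refl
funToFin-cong {suc m} f≗g = cong₂ combine (f≗g Fin.zero) (funToFin-cong (f≗g ∘ Fin.suc))

n<b^n : ∀ {b} → 1 < b → ∀ n → n < b ^ n
n<b^n 1<b zero    = s≤s z≤n
n<b^n {b} 1<b (suc n) = begin-strict
  suc n       ≤⟨ n<b^n 1<b n ⟩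
  b ^ n       ≡⟨ *-identityˡ (b ^ n) ⟨
  1 * b ^ n   <⟨ *-monoˡ-< (b ^ n) {{>-nonZero (≤-<-trans z≤n (n<b^n 1<b n))}} 1<b ⟩
  b * b ^ n   ∎
  where open ≤-Reasoning

b^i*n+a<b^K*n : ∀ {b i K n a} → 1 < b → i < K → a < n → b ^ i * n + a < b ^ K * n
b^i*n+a<b^K*n {b} {i} {K} {n} {a} 1<b i<K a<n = begin-strict
  b ^ i * n + a                  <⟨ +-monoʳ-< (b ^ i * n) a<n ⟩
  b ^ i * n + n                  ≤⟨ +-monoʳ-≤ (b ^ i * n) (m≤n*m n (b ^ i) {{m^n≢0 b i {{b≢0}}}}) ⟩
  b ^ i * n + b ^ i * n          ≡⟨ cong (b ^ i * n +_) (+-identityʳ _) ⟨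
  2 * (b ^ i * n)                ≤⟨ *-monoˡ-≤ (b ^ i * n) 1<b ⟩
  b * (b ^ i * n)                ≡⟨ *-assoc b (b ^ i) n ⟨
  b ^ suc i * n                  ≤⟨ *-monoˡ-≤ n (^-monoʳ-≤ b {{b≢0}} i<K) ⟩
  b ^ K * n                      ∎
  where
  open ≤-Reasoning
  b≢0 : NonZero b
  b≢0 = >-nonZero (<-trans z<s 1<b)

module Congruence (p : ℕ) .{{_ : NonZero p}} where

  infix 4 _≡ₚ_
  _≡ₚ_ : ℕ → ℕ → Set
  x ≡ₚ y = x % p ≡ y % p

  0%p≡0 : 0 % p ≡ 0
  0%p≡0 = m<n⇒m%n≡m (>-nonZero⁻¹ p)

  +-congₚ : ∀ {a a' b b'} → a ≡ₚ a' → b ≡ₚ b' → a + b ≡ₚ a' + b'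
  +-congₚ {a} {a'} {b} {b'} a≡a' b≡b' = begin
    (a + b) % p           ≡⟨ %-distribˡ-+ a b p ⟩
    (a % p + b % p) % p   ≡⟨ cong₂ (λ u v → (u + v) % p) a≡a' b≡b' ⟩
    (a' % p + b' % p) % p ≡⟨ %-distribˡ-+ a' b' p ⟨
    (a' + b') % p         ∎
    where open ≡-Reasoning

  *-congₚ : ∀ {a a' b b'} → a ≡ₚ a' → b ≡ₚ b' → a * b ≡ₚ a' * b'
  *-congₚ {a} {a'} {b} {b'} a≡a' b≡b' = begin
    (a * b) % p             ≡⟨ %-distribˡ-* a b p ⟩
    (a % p * (b % p)) % p   ≡⟨ cong₂ (λ u v → (u * v) % p) a≡a' b≡b' ⟩
    (a' % p * (b' % p)) % p ≡⟨ %-distribˡ-* a' b' p ⟨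
    (a' * b') % p           ∎
    where open ≡-Reasoning

  *-zeroʳₚ : ∀ a {b} → b ≡ₚ 0 → a * b ≡ₚ 0
  *-zeroʳₚ a {b} b≡0 = trans (*-congₚ {a} {a} {b} refl b≡0) (cong (_% p) (*-zeroʳ a))

  *-zeroˡₚ : ∀ {a} b → a ≡ₚ 0 → a * b ≡ₚ 0
  *-zeroˡₚ {a} b a≡0 = trans (*-congₚ {a} {0} {b} a≡0 refl) refl

  ∣⇒≡ₚ0 : ∀ {n} → p ∣ n → n ≡ₚ 0
  ∣⇒≡ₚ0 {n} p∣n = trans (n∣m⇒m%n≡0 n p p∣n) (sym 0%p≡0)

  negₚ : ℕ → ℕ
  negₚ x = p ∸ x % p

  +-inverseʳₚ : ∀ x → x + negₚ x ≡ₚ 0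
  +-inverseʳₚ x = begin
    (x + (p ∸ x % p)) % p                        ≡⟨ cong (λ u → (u + (p ∸ x % p)) % p) x≡r+qp ⟩
    (x % p + (x / p) * p + (p ∸ x % p)) % p     ≡⟨ cong (_% p) (shuffle (x % p) ((x / p) * p) (p ∸ x % p)) ⟩
    ((x / p) * p + (x % p + (p ∸ x % p))) % p   ≡⟨ cong (λ u → ((x / p) * p + u) % p) (m+[n∸m]≡n (m%n≤n x p)) ⟩
    ((x / p) * p + p) % p                        ≡⟨ [m+n]%n≡m%n _ p ⟩
    ((x / p) * p) % p                            ≡⟨ m*n%n≡0 (x / p) p ⟩
    0                                            ≡⟨ 0%p≡0 ⟨
    0 % p                                        ∎
    where
    open ≡-Reasoning
    x≡r+qp : x ≡ x % p + (x / p) * p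
    x≡r+qp = m≡m%n+[m/n]*n x p
    shuffle : ∀ (r q s : ℕ) → r + q + s ≡ q + (r + s)
    shuffle = solve-∀

  +-cancelˡₚ : ∀ a {b c} → a + b ≡ₚ a + c → b ≡ₚ c
  +-cancelˡₚ a {b} {c} a+b≡a+c = begin
    b % p                  ≡⟨ +-congₚ {negₚ a + a} {0} {b} inverse refl ⟨
    (negₚ a + a + b) % p   ≡⟨ cong (_% p) (+-assoc (negₚ a) a b) ⟩
    (negₚ a + (a + b)) % p ≡⟨ +-congₚ {negₚ a} refl a+b≡a+c ⟩
    (negₚ a + (a + c)) % p ≡⟨ cong (_% p) (+-assoc (negₚ a) a c) ⟨
    (negₚ a + a + c) % p   ≡⟨ +-congₚ {negₚ a + a} {0} {c} inverse refl ⟩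
    c % p                  ∎
    where
    open ≡-Reasoning
    inverse : negₚ a + a ≡ₚ 0
    inverse = trans (cong (_% p) (+-comm (negₚ a) a)) (+-inverseʳₚ a)

  toℕ-injectiveₚ : ∀ {u v : Fin p} → toℕ u ≡ₚ toℕ v → u ≡ v
  toℕ-injectiveₚ {u} {v} u≡v = toℕ-injective (trans (sym (m<n⇒m%n≡m (toℕ<n u))) (trans u≡v (m<n⇒m%n≡m (toℕ<n v))))

  module _ (pp : Prime p) where

    *-nonzeroₚ : ∀ {a b} → ¬ (a ≡ₚ 0) → ¬ (b ≡ₚ 0) → ¬ (a * b ≡ₚ 0)
    *-nonzeroₚ {a} {b} a≢0 b≢0 ab≡0 with euclidsLemma a b pp (m%n≡0⇒n∣m _ p (trans ab≡0 0%p≡0))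
    ... | inj₁ p∣a = a≢0 (∣⇒≡ₚ0 p∣a)
    ... | inj₂ p∣b = b≢0 (∣⇒≡ₚ0 p∣b)

    -- b − c is represented by b + negₚ c, which a annihilates.
    *-cancelˡₚ : ∀ {a b c} → ¬ (a ≡ₚ 0) → a * b ≡ₚ a * c → b ≡ₚ c
    *-cancelˡₚ {a} {b} {c} a≢0 ab≡ac = +-cancelˡₚ (negₚ c) (begin
      (negₚ c + b) % p ≡⟨ cong (_% p) (+-comm (negₚ c) b) ⟩
      (b + negₚ c) % p ≡⟨ difference≡0 ⟩
      0 % p            ≡⟨ +-inverseʳₚ c ⟨
      (c + negₚ c) % p ≡⟨ cong (_% p) (+-comm c (negₚ c)) ⟩
      (negₚ c + c) % p ∎)
      where
      open ≡-Reasoning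
      annihilated : a * (b + negₚ c) ≡ₚ 0
      annihilated = begin
        (a * (b + negₚ c)) % p     ≡⟨ cong (_% p) (*-distribˡ-+ a b (negₚ c)) ⟩
        (a * b + a * negₚ c) % p   ≡⟨ +-congₚ {a * b} ab≡ac refl ⟩
        (a * c + a * negₚ c) % p   ≡⟨ cong (_% p) (*-distribˡ-+ a c (negₚ c)) ⟨
        (a * (c + negₚ c)) % p     ≡⟨ *-zeroʳₚ a (+-inverseʳₚ c) ⟩
        0 % p                      ∎
      difference≡0 : b + negₚ c ≡ₚ 0
      difference≡0 with (b + negₚ c) % p ≟ 0
      ... | yes d≡0 = trans d≡0 (sym 0%p≡0)
      ... | no d≢0 = contradiction annihilated (*-nonzeroₚ a≢0 (d≢0 ∘ (λ e → trans e 0%p≡0)))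

module SeriesArithmetic where

  tail : Series → Series
  tail a n = a (suc n)

  scale : ℕ → Series → Series
  scale k a n = k * a n

  constant : ℕ → Series
  constant k zero    = k
  constant k (suc n) = 0

  oneS : Series
  oneS = constant 1

  map-applyUpTo : ∀ {A B : Set} (g : A → B) (f : ℕ → A) n → map g (applyUpTo f n) ≡ applyUpTo (g ∘ f) n
  map-applyUpTo g f zero    = refl
  map-applyUpTo g f (suc n) = cong (g (f 0) ∷_) (map-applyUpTo g (f ∘ suc) n)

  mulS-suc : ∀ a b n → mulS a b (suc n) ≡ a 0 * b (suc n) + mulS (tail a) b n
  mulS-suc a b n = cong (a 0 * b (suc n) +_) (begin
    sum (map (λ k → a k * b (suc n ∸ k)) (applyUpTo suc (suc n)))     ≡⟨ cong sum (map-applyUpTo _ suc (suc n)) ⟩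
    sum (applyUpTo (λ k → a (suc k) * b (n ∸ k)) (suc n))            ≡⟨ cong sum (map-applyUpTo _ (λ k → k) (suc n)) ⟨
    sum (map (λ k → a (suc k) * b (n ∸ k)) (applyUpTo (λ k → k) (suc n))) ∎)
    where open ≡-Reasoning

  mulS-cong : ∀ {a a' b b'} → a ≗ a' → b ≗ b' → mulS a b ≗ mulS a' b'
  mulS-cong a≗a' b≗b' zero = cong₂ (λ u v → u * v + 0) (a≗a' 0) (b≗b' 0)
  mulS-cong {a} {a'} {b} {b'} a≗a' b≗b' (suc n) = begin
    mulS a b (suc n)                        ≡⟨ mulS-suc a b n ⟩
    a 0 * b (suc n) + mulS (tail a) b n     ≡⟨ cong₂ _+_ (cong₂ _*_ (a≗a' 0) (b≗b' (suc n))) (mulS-cong (a≗a' ∘ suc) b≗b' n) ⟩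
    a' 0 * b' (suc n) + mulS (tail a') b' n ≡⟨ mulS-suc a' b' n ⟨
    mulS a' b' (suc n)                      ∎
    where open ≡-Reasoning

  mulS-zeroˡ : ∀ b → mulS zeroS b ≗ zeroS
  mulS-zeroˡ b zero    = refl
  mulS-zeroˡ b (suc n) = trans (mulS-suc zeroS b n) (mulS-zeroˡ b n)

  mulS-constantˡ : ∀ k a → mulS (constant k) a ≗ scale k a
  mulS-constantˡ k a zero    = +-identityʳ _
  mulS-constantˡ k a (suc n) = begin
    mulS (constant k) a (suc n)          ≡⟨ mulS-suc (constant k) a n ⟩
    k * a (suc n) + mulS zeroS a n       ≡⟨ cong (k * a (suc n) +_) (mulS-zeroˡ a n) ⟩
    k * a (suc n) + 0                    ≡⟨ +-identityʳ _ ⟩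
    k * a (suc n)                        ∎
    where open ≡-Reasoning

  mulS-identityˡ : ∀ b → mulS oneS b ≗ b
  mulS-identityˡ b n = trans (mulS-constantˡ 1 b n) (*-identityˡ (b n))

  mulS-scaleˡ : ∀ k a b → mulS (scale k a) b ≗ scale k (mulS a b)
  mulS-scaleˡ k a b zero = lemma k (a 0) (b 0)
    where lemma : ∀ (x y z : ℕ) → x * y * z + 0 ≡ x * (y * z + 0)
          lemma = solve-∀
  mulS-scaleˡ k a b (suc n) = begin
    mulS (scale k a) b (suc n)                       ≡⟨ mulS-suc (scale k a) b n ⟩
    k * a 0 * b (suc n) + mulS (scale k (tail a)) b n ≡⟨ cong (k * a 0 * b (suc n) +_) (mulS-scaleˡ k (tail a) b n) ⟩
    k * a 0 * b (suc n) + k * mulS (tail a) b n       ≡⟨ lemma k (a 0) (b (suc n)) (mulS (tail a) b n) ⟩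
    k * (a 0 * b (suc n) + mulS (tail a) b n)         ≡⟨ cong (k *_) (mulS-suc a b n) ⟨
    k * mulS a b (suc n)                              ∎
    where open ≡-Reasoning
          lemma : ∀ (x y z w : ℕ) → x * y * z + x * w ≡ x * (y * z + w)
          lemma = solve-∀

  mulS-distribʳ : ∀ a b c → mulS (addS a b) c ≗ addS (mulS a c) (mulS b c)
  mulS-distribʳ a b c zero = lemma (a 0) (b 0) (c 0)
    where lemma : ∀ (x y z : ℕ) → (x + y) * z + 0 ≡ x * z + 0 + (y * z + 0)
          lemma = solve-∀
  mulS-distribʳ a b c (suc n) = begin
    mulS (addS a b) c (suc n)                                                   ≡⟨ mulS-suc (addS a b) c n ⟩
    (a 0 + b 0) * c (suc n) + mulS (addS (tail a) (tail b)) c n                 ≡⟨ cong ((a 0 + b 0) * c (suc n) +_) (mulS-distribʳ (tail a) (tail b) c n) ⟩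
    (a 0 + b 0) * c (suc n) + (mulS (tail a) c n + mulS (tail b) c n)           ≡⟨ lemma (a 0) (b 0) (c (suc n)) _ _ ⟩
    (a 0 * c (suc n) + mulS (tail a) c n) + (b 0 * c (suc n) + mulS (tail b) c n) ≡⟨ cong₂ _+_ (mulS-suc a c n) (mulS-suc b c n) ⟨
    mulS a c (suc n) + mulS b c (suc n)                                         ∎
    where open ≡-Reasoning
          lemma : ∀ (x y z u v : ℕ) → (x + y) * z + (u + v) ≡ (x * z + u) + (y * z + v)
          lemma = solve-∀

  -- Commutativity at n + 2 uses it at n and n + 1, so both are proved together.
  mulS-comm-upto : ∀ n → (∀ a b → mulS a b n ≡ mulS b a n) × (∀ a b → mulS a b (suc n) ≡ mulS b a (suc n))
  mulS-comm-upto zero = (λ a b → cong (_+ 0) (*-comm (a 0) (b 0))) , λ a b → lemma (a 0) (a 1) (b 0) (b 1)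
    where lemma : ∀ (x y z w : ℕ) → x * w + (y * z + 0) ≡ z * y + (w * x + 0)
          lemma = solve-∀
  mulS-comm-upto (suc n) with mulS-comm-upto n
  ... | comm₀ , comm₁ = comm₁ , comm₂
    where
    comm₂ : ∀ a b → mulS a b (suc (suc n)) ≡ mulS b a (suc (suc n))
    comm₂ a b = begin
      mulS a b (suc (suc n))                                                   ≡⟨ mulS-suc a b (suc n) ⟩
      a 0 * b (2 + n) + mulS (tail a) b (suc n)                               ≡⟨ cong (a 0 * b (2 + n) +_) (trans (comm₁ (tail a) b) (mulS-suc b (tail a) n)) ⟩
      a 0 * b (2 + n) + (b 0 * a (2 + n) + mulS (tail b) (tail a) n)          ≡⟨ cong (λ z → a 0 * b (2 + n) + (b 0 * a (2 + n) + z)) (comm₀ (tail b) (tail a)) ⟩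
      a 0 * b (2 + n) + (b 0 * a (2 + n) + mulS (tail a) (tail b) n)          ≡⟨ lemma (a 0 * b (2 + n)) (b 0 * a (2 + n)) _ ⟩
      b 0 * a (2 + n) + (a 0 * b (2 + n) + mulS (tail a) (tail b) n)          ≡⟨ cong (b 0 * a (2 + n) +_) (trans (comm₁ (tail b) a) (mulS-suc a (tail b) n)) ⟨
      b 0 * a (2 + n) + mulS (tail b) a (suc n)                               ≡⟨ mulS-suc b a (suc n) ⟨
      mulS b a (suc (suc n))                                                   ∎
      where open ≡-Reasoning
            lemma : ∀ (x y z : ℕ) → x + (y + z) ≡ y + (x + z)
            lemma = solve-∀

  mulS-comm : ∀ a b → mulS a b ≗ mulS b a
  mulS-comm a b n = proj₁ (mulS-comm-upto n) a b

  mulS-zeroʳ : ∀ a → mulS a zeroS ≗ zeroS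
  mulS-zeroʳ a n = trans (mulS-comm a zeroS n) (mulS-zeroˡ a n)

  mulS-tail : ∀ a b → tail (mulS a b) ≗ addS (scale (a 0) (tail b)) (mulS (tail a) b)
  mulS-tail a b n = mulS-suc a b n

  mulS-assoc : ∀ a b c → mulS (mulS a b) c ≗ mulS a (mulS b c)
  mulS-assoc a b c zero = lemma (a 0) (b 0) (c 0)
    where lemma : ∀ (x y z : ℕ) → (x * y + 0) * z + 0 ≡ x * (y * z + 0) + 0
          lemma = solve-∀
  mulS-assoc a b c (suc n) = begin
    mulS (mulS a b) c (suc n)                                       ≡⟨ mulS-suc (mulS a b) c n ⟩
    ab₀ * c (suc n) + mulS (tail (mulS a b)) c n                    ≡⟨ cong (ab₀ * c (suc n) +_) (mulS-cong {b = c} (mulS-tail a b) (λ _ → refl) n) ⟩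
    ab₀ * c (suc n) + mulS (addS (scale (a 0) (tail b)) (mulS (tail a) b)) c n
                                                                    ≡⟨ cong (ab₀ * c (suc n) +_) (mulS-distribʳ (scale (a 0) (tail b)) (mulS (tail a) b) c n) ⟩
    ab₀ * c (suc n) + (mulS (scale (a 0) (tail b)) c n + mulS (mulS (tail a) b) c n)
                                                                    ≡⟨ cong₂ (λ u v → ab₀ * c (suc n) + (u + v)) (mulS-scaleˡ (a 0) (tail b) c n) (mulS-assoc (tail a) b c n) ⟩
    ab₀ * c (suc n) + (a 0 * mulS (tail b) c n + mulS (tail a) (mulS b c) n)
                                                                    ≡⟨ lemma (a 0) (b 0) (c (suc n)) _ _ ⟩
    a 0 * (b 0 * c (suc n) + mulS (tail b) c n) + mulS (tail a) (mulS b c) n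
                                                                    ≡⟨ cong (λ z → a 0 * z + mulS (tail a) (mulS b c) n) (mulS-suc b c n) ⟨
    a 0 * mulS b c (suc n) + mulS (tail a) (mulS b c) n             ≡⟨ mulS-suc a (mulS b c) n ⟨
    mulS a (mulS b c) (suc n)                                       ∎
    where open ≡-Reasoning
          ab₀ = a 0 * b 0 + 0
          lemma : ∀ (x y z u v : ℕ) → (x * y + 0) * z + (x * u + v) ≡ x * (y * z + u) + v
          lemma = solve-∀

  infixl 6 _⊕_
  infixl 7 _⊛_

  -- Opaque copies of addS and mulS keep the convolution from being unfolded during unification.
  opaque
    _⊕_ : Series → Series → Series
    _⊕_ = addS

    _⊛_ : Series → Series → Series
    _⊛_ = mulS

  opaque
    unfolding _⊕_ _⊛_

    ⊕-def : ∀ a b n → (a ⊕ b) n ≡ a n + b n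
    ⊕-def a b n = refl

    ⊛-def : ∀ a b n → (a ⊛ b) n ≡ mulS a b n
    ⊛-def a b n = refl

module SeriesModP (p : ℕ) .{{_ : NonZero p}} where

  open Congruence p
  open SeriesArithmetic

  infix 4 _≈ₛ_
  record _≈ₛ_ (a b : Series) : Set where
    constructor mkₛ
    field at : ∀ n → a n ≡ₚ b n
  open _≈ₛ_ public

  ≗⇒≈ₛ : ∀ {a b} → a ≗ b → a ≈ₛ b
  ≗⇒≈ₛ a≗b = mkₛ λ n → cong (_% p) (a≗b n)

  mulS-congₚ : ∀ {a a' b b'} → (∀ n → a n ≡ₚ a' n) → (∀ n → b n ≡ₚ b' n) → ∀ n → mulS a b n ≡ₚ mulS a' b' n
  mulS-congₚ {a} {a'} {b} {b'} a≡a' b≡b' zero =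
    +-congₚ {a 0 * b 0} {a' 0 * b' 0} {0} {0} (*-congₚ {a 0} {a' 0} (a≡a' 0) (b≡b' 0)) refl
  mulS-congₚ {a} {a'} {b} {b'} a≡a' b≡b' (suc n) = begin
    mulS a b (suc n) % p                            ≡⟨ cong (_% p) (mulS-suc a b n) ⟩
    (a 0 * b (suc n) + mulS (tail a) b n) % p       ≡⟨ +-congₚ {a 0 * b (suc n)} (*-congₚ {a 0} (a≡a' 0) (b≡b' (suc n))) (mulS-congₚ (a≡a' ∘ suc) b≡b' n) ⟩
    (a' 0 * b' (suc n) + mulS (tail a') b' n) % p   ≡⟨ cong (_% p) (mulS-suc a' b' n) ⟨
    mulS a' b' (suc n) % p                          ∎
    where open ≡-Reasoning

  ⊕-cong : ∀ {a a' b b'} → a ≈ₛ a' → b ≈ₛ b' → a ⊕ b ≈ₛ a' ⊕ b'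
  ⊕-cong {a} {a'} {b} {b'} a≈a' b≈b' = mkₛ λ n → begin
    (a ⊕ b) n % p       ≡⟨ cong (_% p) (⊕-def a b n) ⟩
    (a n + b n) % p     ≡⟨ +-congₚ {a n} (at a≈a' n) (at b≈b' n) ⟩
    (a' n + b' n) % p   ≡⟨ cong (_% p) (⊕-def a' b' n) ⟨
    (a' ⊕ b') n % p     ∎
    where open ≡-Reasoning

  ⊛-cong : ∀ {a a' b b'} → a ≈ₛ a' → b ≈ₛ b' → a ⊛ b ≈ₛ a' ⊛ b'
  ⊛-cong {a} {a'} {b} {b'} a≈a' b≈b' = mkₛ λ n → begin
    (a ⊛ b) n % p      ≡⟨ cong (_% p) (⊛-def a b n) ⟩
    mulS a b n % p     ≡⟨ mulS-congₚ (at a≈a') (at b≈b') n ⟩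
    mulS a' b' n % p   ≡⟨ cong (_% p) (⊛-def a' b' n) ⟨
    (a' ⊛ b') n % p    ∎
    where open ≡-Reasoning

  ⊕-via-addS : ∀ {a b c d} → addS a b ≗ addS c d → a ⊕ b ≈ₛ c ⊕ d
  ⊕-via-addS {a} {b} {c} {d} e = ≗⇒≈ₛ λ n → trans (⊕-def a b n) (trans (e n) (sym (⊕-def c d n)))

  ⊛-via-mulS : ∀ {a b c d} → mulS a b ≗ mulS c d → a ⊛ b ≈ₛ c ⊛ d
  ⊛-via-mulS {a} {b} {c} {d} e = ≗⇒≈ₛ λ n → trans (⊛-def a b n) (trans (e n) (sym (⊛-def c d n)))

  ≈ₛ-isEquivalence : IsEquivalence _≈ₛ_
  ≈ₛ-isEquivalence = record
    { refl  = mkₛ λ n → refl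
    ; sym   = λ e → mkₛ λ n → sym (at e n)
    ; trans = λ e f → mkₛ λ n → trans (at e n) (at f n)
    }

  ⊕-isCommutativeMonoid : IsCommutativeMonoid _≈ₛ_ _⊕_ zeroS
  ⊕-isCommutativeMonoid = record
    { isMonoid = record
      { isSemigroup = record
        { isMagma = record { isEquivalence = ≈ₛ-isEquivalence ; ∙-cong = ⊕-cong }
        ; assoc   = λ a b c → ≗⇒≈ₛ λ n → begin
            ((a ⊕ b) ⊕ c) n     ≡⟨ trans (⊕-def (a ⊕ b) c n) (cong (_+ c n) (⊕-def a b n)) ⟩
            a n + b n + c n     ≡⟨ +-assoc (a n) (b n) (c n) ⟩
            a n + (b n + c n)   ≡⟨ trans (⊕-def a (b ⊕ c) n) (cong (a n +_) (⊕-def b c n)) ⟨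
            (a ⊕ (b ⊕ c)) n     ∎
        }
      ; identity = (λ a → ≗⇒≈ₛ (⊕-def zeroS a))
                 , (λ a → ≗⇒≈ₛ λ n → trans (⊕-def a zeroS n) (+-identityʳ (a n)))
      }
    ; comm = λ a b → ⊕-via-addS λ n → +-comm (a n) (b n)
    }
    where open ≡-Reasoning

  ⊛-isCommutativeMonoid : IsCommutativeMonoid _≈ₛ_ _⊛_ oneS
  ⊛-isCommutativeMonoid = record
    { isMonoid = record
      { isSemigroup = record
        { isMagma = record { isEquivalence = ≈ₛ-isEquivalence ; ∙-cong = ⊛-cong }
        ; assoc   = λ a b c → ≗⇒≈ₛ λ n → begin
            ((a ⊛ b) ⊛ c) n         ≡⟨ trans (⊛-def (a ⊛ b) c n) (mulS-cong {b = c} (⊛-def a b) (λ _ → refl) n) ⟩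
            mulS (mulS a b) c n     ≡⟨ mulS-assoc a b c n ⟩
            mulS a (mulS b c) n     ≡⟨ trans (⊛-def a (b ⊛ c) n) (mulS-cong {a = a} (λ _ → refl) (⊛-def b c) n) ⟨
            (a ⊛ (b ⊛ c)) n         ∎
        }
      ; identity = (λ a → ≗⇒≈ₛ λ n → trans (⊛-def oneS a n) (mulS-identityˡ a n))
                 , (λ a → ≗⇒≈ₛ λ n → trans (⊛-def a oneS n) (trans (mulS-comm a oneS n) (mulS-identityˡ a n)))
      }
    ; comm = λ a b → ⊛-via-mulS (mulS-comm a b)
    }
    where open ≡-Reasoning

  seriesSemiring : CommutativeSemiring 0ℓ 0ℓ
  seriesSemiring = record
    { Carrier = Series ; _≈_ = _≈ₛ_ ; _+_ = _⊕_ ; _*_ = _⊛_ ; 0# = zeroS ; 1# = oneS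
    ; isCommutativeSemiring = IsCommutativeSemiringˡ.isCommutativeSemiring (record
      { +-isCommutativeMonoid = ⊕-isCommutativeMonoid
      ; *-isCommutativeMonoid = ⊛-isCommutativeMonoid
      ; distribʳ = λ c a b → ≗⇒≈ₛ λ n → begin
          ((a ⊕ b) ⊛ c) n               ≡⟨ trans (⊛-def (a ⊕ b) c n) (mulS-cong {b = c} (⊕-def a b) (λ _ → refl) n) ⟩
          mulS (addS a b) c n           ≡⟨ mulS-distribʳ a b c n ⟩
          mulS a c n + mulS b c n       ≡⟨ trans (⊕-def (a ⊛ c) (b ⊛ c) n) (cong₂ _+_ (⊛-def a c n) (⊛-def b c n)) ⟨
          (a ⊛ c ⊕ b ⊛ c) n             ∎
      ; zeroˡ = λ b → ≗⇒≈ₛ λ n → trans (⊛-def zeroS b n) (mulS-zeroˡ b n)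
      })
    }
    where
    open ≡-Reasoning
    open import Algebra.Structures.Biased using (IsCommutativeSemiringˡ)

  open CommutativeSemiring seriesSemiring using (semiring)
  open import Algebra.Properties.Semiring.Mult semiring using () renaming (_×_ to _·_)

  ·-pointwise : ∀ n a → n · a ≈ₛ scale n a
  ·-pointwise zero    a = mkₛ λ k → refl
  ·-pointwise (suc n) a = mkₛ λ k → trans (cong (_% p) (⊕-def a (n · a) k)) (+-congₚ {a k} refl (at (·-pointwise n a) k))

  p·1≈0 : p · oneS ≈ₛ zeroS
  p·1≈0 = mkₛ λ k → trans (at (·-pointwise p oneS) k) (∣⇒≡ₚ0 (divides (oneS k) (*-comm p (oneS k))))

  ⊕-cancelˡ : ∀ {a a' x y} → a ⊕ x ≈ₛ a' ⊕ y → a ≈ₛ a' → x ≈ₛ y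
  ⊕-cancelˡ {a} {a'} {x} {y} a+x≈a'+y a≈a' = mkₛ λ n → +-cancelˡₚ (a n) (begin
    (a n + x n) % p    ≡⟨ cong (_% p) (⊕-def a x n) ⟨
    (a ⊕ x) n % p      ≡⟨ at a+x≈a'+y n ⟩
    (a' ⊕ y) n % p     ≡⟨ cong (_% p) (⊕-def a' y n) ⟩
    (a' n + y n) % p   ≡⟨ +-congₚ {a' n} {a n} {y n} (sym (at a≈a' n)) refl ⟩
    (a n + y n) % p    ∎)
    where open ≡-Reasoning

  ⊕-cancelʳ-at : ∀ {a b a' b'} n → (a ⊕ b) n ≡ₚ (a' ⊕ b') n → b n ≡ₚ b' n → a n ≡ₚ a' n
  ⊕-cancelʳ-at {a} {b} {a'} {b'} n a+b≡a'+b' b≡b' = +-cancelˡₚ (b n) (begin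
    (b n + a n) % p     ≡⟨ cong (_% p) (trans (+-comm (b n) (a n)) (sym (⊕-def a b n))) ⟩
    (a ⊕ b) n % p       ≡⟨ a+b≡a'+b' ⟩
    (a' ⊕ b') n % p     ≡⟨ cong (_% p) (trans (⊕-def a' b' n) (+-comm (a' n) (b' n))) ⟩
    (b' n + a' n) % p   ≡⟨ +-congₚ {b' n} (sym b≡b') refl ⟩
    (b n + a' n) % p    ∎)
    where open ≡-Reasoning

  difference : (ℕ → Fin p) → (ℕ → Fin p) → Series
  difference f g n = toℕ (f n) + (p ∸ toℕ (g n))

  liftS≈liftS⊕difference : ∀ f g → liftS f ≈ₛ liftS g ⊕ difference f g
  liftS≈liftS⊕difference f g = mkₛ λ n → sym (begin
    (liftS g ⊕ difference f g) n % p               ≡⟨ cong (_% p) (⊕-def (liftS g) (difference f g) n) ⟩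
    (toℕ (g n) + (toℕ (f n) + (p ∸ toℕ (g n)))) % p ≡⟨ cong (_% p) (x+[y+z]≡y+[x+z] (toℕ (g n)) (toℕ (f n)) _) ⟩
    (toℕ (f n) + (toℕ (g n) + (p ∸ toℕ (g n)))) % p ≡⟨ cong (λ z → (toℕ (f n) + z) % p) (m+[n∸m]≡n (<⇒≤ (toℕ<n (g n)))) ⟩
    (toℕ (f n) + p) % p                            ≡⟨ [m+n]%n≡m%n (toℕ (f n)) p ⟩
    toℕ (f n) % p                                  ∎)
    where
    open ≡-Reasoning
    x+[y+z]≡y+[x+z] : ∀ (x y z : ℕ) → x + (y + z) ≡ y + (x + z)
    x+[y+z]≡y+[x+z] = solve-∀

  difference≡0 : ∀ f g n → f n ≡ g n → difference f g n ≡ₚ 0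
  difference≡0 f g n fₙ≡gₙ = begin
    (toℕ (f n) + (p ∸ toℕ (g n))) % p  ≡⟨ cong (λ z → (toℕ z + (p ∸ toℕ (g n))) % p) fₙ≡gₙ ⟩
    (toℕ (g n) + (p ∸ toℕ (g n))) % p  ≡⟨ cong (_% p) (m+[n∸m]≡n (<⇒≤ (toℕ<n (g n)))) ⟩
    p % p                              ≡⟨ n%n≡0 p ⟩
    0                                  ≡⟨ 0%p≡0 ⟨
    0 % p                              ∎
    where open ≡-Reasoning

  difference≢0 : ∀ f g n → f n ≢ g n → ¬ (difference f g n ≡ₚ 0)
  difference≢0 f g n fₙ≢gₙ h≡0 = fₙ≢gₙ (toℕ-injectiveₚ (begin
    toℕ (f n) % p                              ≡⟨ at (liftS≈liftS⊕difference f g) n ⟩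
    (liftS g ⊕ difference f g) n % p           ≡⟨ cong (_% p) (⊕-def (liftS g) (difference f g) n) ⟩
    (toℕ (g n) + difference f g n) % p         ≡⟨ +-congₚ {toℕ (g n)} refl h≡0 ⟩
    (toℕ (g n) + 0) % p                        ≡⟨ cong (_% p) (+-identityʳ _) ⟩
    toℕ (g n) % p                              ∎))
    where open ≡-Reasoning

module Order (p : ℕ) (pp : Prime p) where

  private instance
    p-nonZero : NonZero p
    p-nonZero = prime⇒nonZero pp

  open Congruence p
  open SeriesArithmetic
  open SeriesModP p
  open CommutativeSemiring seriesSemiring using (semiring)
  open import Algebra.Properties.Semiring.Exp semiring using () renaming (_^_ to _^ₛ_)
  open PrimeBinomial using (prime>1)

  VanishesBelow : Series → ℕ → Set
  VanishesBelow a v = ∀ k → k < v → a k ≡ₚ 0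

  VanishesAbove : Series → ℕ → Set
  VanishesAbove a α = ∀ k → α < k → a k ≡ₚ 0

  HasOrder : Series → ℕ → Set
  HasOrder a v = VanishesBelow a v × ¬ (a v ≡ₚ 0)

  mulS-sucₚ : ∀ a b n {x y} → a 0 * b (suc n) ≡ₚ x → mulS (tail a) b n ≡ₚ y → mulS a b (suc n) ≡ₚ x + y
  mulS-sucₚ a b n head≡x tail≡y = trans (cong (_% p) (mulS-suc a b n)) (+-congₚ {a 0 * b (suc n)} head≡x tail≡y)

  mulS-congʳ-upto : ∀ N a {b b'} → (∀ j → j ≤ N → b j ≡ₚ b' j) → mulS a b N ≡ₚ mulS a b' N
  mulS-congʳ-upto zero    a {b} {b'} b≡b' = +-congₚ {a 0 * b 0} {a 0 * b' 0} {0} (*-congₚ {a 0} refl (b≡b' 0 z≤n)) refl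
  mulS-congʳ-upto (suc N) a {b} {b'} b≡b' = trans
    (mulS-sucₚ a b N (*-congₚ {a 0} refl (b≡b' (suc N) ≤-refl)) (mulS-congʳ-upto N (tail a) λ j j≤N → b≡b' j (m≤n⇒m≤1+n j≤N)))
    (cong (_% p) (sym (mulS-suc a b' N)))

  mulS-vanishes-below : ∀ α β a b → VanishesBelow a α → VanishesBelow b β → VanishesBelow (mulS a b) (α + β)
  mulS-vanishes-below zero β a b _ b<β≡0 N N<β =
    trans (mulS-congʳ-upto N a λ j j≤N → b<β≡0 j (≤-<-trans j≤N N<β)) (cong (_% p) (mulS-zeroʳ a N))
  mulS-vanishes-below (suc α) β a b a<α≡0 _ zero _ =
    +-congₚ {a 0 * b 0} {0} {0} (*-zeroˡₚ (b 0) (a<α≡0 0 z<s)) refl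
  mulS-vanishes-below (suc α) β a b a<α≡0 b<β≡0 (suc N) N<α+β =
    mulS-sucₚ a b N (*-zeroˡₚ (b (suc N)) (a<α≡0 0 z<s))
              (mulS-vanishes-below α β (tail a) b (λ k k<α → a<α≡0 (suc k) (s<s k<α)) b<β≡0 N (s<s⁻¹ N<α+β))

  mulS-vanishes-above : ∀ α β a b → VanishesAbove a α → VanishesAbove b β → VanishesAbove (mulS a b) (α + β)
  mulS-vanishes-above α β a b _ _ zero ()
  mulS-vanishes-above zero β a b a>0≡0 b>β≡0 (suc N) β<N+1 =
    mulS-sucₚ a b N (*-zeroʳₚ (a 0) (b>β≡0 (suc N) β<N+1))
              (trans (mulS-congₚ {b = b} (λ k → a>0≡0 (suc k) z<s) (λ _ → refl) N) (cong (_% p) (mulS-zeroˡ b N)))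
  mulS-vanishes-above (suc α) β a b a>α≡0 b>β≡0 (suc N) α+β<N =
    mulS-sucₚ a b N (*-zeroʳₚ (a 0) (b>β≡0 (suc N) (<-trans (s≤s (m≤n+m β α)) α+β<N)))
              (mulS-vanishes-above α β (tail a) b (λ k α<k → a>α≡0 (suc k) (s<s α<k)) b>β≡0 N (s<s⁻¹ α+β<N))

  VanishesAbove-≈ₛ : ∀ {a b α} → a ≈ₛ b → VanishesAbove b α → VanishesAbove a α
  VanishesAbove-≈ₛ a≈b b>α≡0 k α<k = trans (at a≈b k) (b>α≡0 k α<k)

  ⊕-vanishes-above : ∀ {a b α} → VanishesAbove a α → VanishesAbove b α → VanishesAbove (a ⊕ b) α
  ⊕-vanishes-above {a} {b} a>α≡0 b>α≡0 k α<k =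
    trans (cong (_% p) (⊕-def a b k)) (+-congₚ {a k} {0} {b k} (a>α≡0 k α<k) (b>α≡0 k α<k))

  ⊛-vanishes-above : ∀ α β {a b} → VanishesAbove a α → VanishesAbove b β → VanishesAbove (a ⊛ b) (α + β)
  ⊛-vanishes-above α β {a} {b} a>α≡0 b>β≡0 k α+β<k =
    trans (cong (_% p) (⊛-def a b k)) (mulS-vanishes-above α β a b a>α≡0 b>β≡0 k α+β<k)

  -- (a·b)_{v+n} = a_v·b_n + (terms in b_0, …, b_{n−1}), stated without subtraction.
  mulS-exchange : ∀ v n a b b' → VanishesBelow a v → (∀ j → j < n → b j ≡ₚ b' j) →
    mulS a b (v + n) + a v * b' n ≡ₚ mulS a b' (v + n) + a v * b n
  mulS-exchange zero zero a b b' _ _ = cong (_% p) (swap (a 0) (b 0) (b' 0))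
    where swap : ∀ (x y z : ℕ) → x * y + 0 + x * z ≡ x * z + 0 + x * y
          swap = solve-∀
  mulS-exchange zero (suc n) a b b' _ b≡b' = begin
    (mulS a b (suc n) + a 0 * b' (suc n)) % p                         ≡⟨ cong (λ z → (z + a 0 * b' (suc n)) % p) (mulS-suc a b n) ⟩
    (a 0 * b (suc n) + mulS (tail a) b n + a 0 * b' (suc n)) % p      ≡⟨ +-congₚ {a 0 * b (suc n) + mulS (tail a) b n} (+-congₚ {a 0 * b (suc n)} refl tails) refl ⟩
    (a 0 * b (suc n) + mulS (tail a) b' n + a 0 * b' (suc n)) % p     ≡⟨ cong (_% p) (swap (a 0 * b (suc n)) (mulS (tail a) b' n) (a 0 * b' (suc n))) ⟩
    (a 0 * b' (suc n) + mulS (tail a) b' n + a 0 * b (suc n)) % p     ≡⟨ cong (λ z → (z + a 0 * b (suc n)) % p) (mulS-suc a b' n) ⟨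
    (mulS a b' (suc n) + a 0 * b (suc n)) % p                         ∎
    where open ≡-Reasoning
          tails : mulS (tail a) b n ≡ₚ mulS (tail a) b' n
          tails = mulS-congʳ-upto n (tail a) λ j j≤n → b≡b' j (s≤s j≤n)
          swap : ∀ (x y z : ℕ) → x + y + z ≡ z + y + x
          swap = solve-∀
  mulS-exchange (suc v) n a b b' a<v≡0 b≡b' = begin
    (mulS a b (suc (v + n)) + a (suc v) * b' n) % p     ≡⟨ +-congₚ {mulS a b (suc (v + n))} (drop-head b) refl ⟩
    (mulS (tail a) b (v + n) + a (suc v) * b' n) % p    ≡⟨ mulS-exchange v n (tail a) b b' (λ k k<v → a<v≡0 (suc k) (s<s k<v)) b≡b' ⟩
    (mulS (tail a) b' (v + n) + a (suc v) * b n) % p    ≡⟨ +-congₚ {mulS a b' (suc (v + n))} (drop-head b') refl ⟨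
    (mulS a b' (suc (v + n)) + a (suc v) * b n) % p     ∎
    where open ≡-Reasoning
          drop-head : ∀ c → mulS a c (suc (v + n)) ≡ₚ mulS (tail a) c (v + n)
          drop-head c = mulS-sucₚ a c (v + n) (*-zeroˡₚ (c (suc (v + n))) (a<v≡0 0 z<s)) refl

  mulS-leading : ∀ α β a b → VanishesBelow a α → VanishesBelow b β → mulS a b (α + β) ≡ₚ a α * b β
  mulS-leading α β a b a<α≡0 b<β≡0 = +-cancelˡₚ (a α * 0) (begin
    (a α * 0 + mulS a b (α + β)) % p      ≡⟨ cong (_% p) (+-comm (a α * 0) _) ⟩
    (mulS a b (α + β) + a α * 0) % p      ≡⟨ mulS-exchange α β a b zeroS a<α≡0 b<β≡0 ⟩
    (mulS a zeroS (α + β) + a α * b β) % p ≡⟨ cong (λ z → (z + a α * b β) % p) (trans (mulS-zeroʳ a (α + β)) (sym (*-zeroʳ (a α)))) ⟩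
    (a α * 0 + a α * b β) % p              ∎)
    where open ≡-Reasoning

  1≢ₚ0 : ¬ (1 ≡ₚ 0)
  1≢ₚ0 1≡0 = contradiction (trans (sym (m<n⇒m%n≡m (prime>1 pp))) (trans 1≡0 0%p≡0)) λ ()

  HasOrder-^ : ∀ {h n} → HasOrder h n → ∀ q → HasOrder (h ^ₛ q) (q * n)
  HasOrder-^ h-order zero = (λ k ()) , 1≢ₚ0
  HasOrder-^ {h} {n} h-order@(h<n≡0 , hₙ≢0) (suc q) with HasOrder-^ h-order q
  ... | hq<qn≡0 , hqₙ≢0 =
    (λ k k<n+qn → trans (cong (_% p) (⊛-def h (h ^ₛ q) k)) (mulS-vanishes-below n (q * n) h (h ^ₛ q) h<n≡0 hq<qn≡0 k k<n+qn)) ,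
    λ lead≡0 → *-nonzeroₚ pp hₙ≢0 hqₙ≢0
      (trans (sym (mulS-leading n (q * n) h (h ^ₛ q) h<n≡0 hq<qn≡0)) (trans (cong (_% p) (sym (⊛-def h (h ^ₛ q) (n + q * n)))) lead≡0))

  ⊛-exchange : ∀ v n {a b b'} → VanishesBelow a v → (∀ j → j < n → b j ≡ₚ b' j) →
    (a ⊛ b) (v + n) + a v * b' n ≡ₚ (a ⊛ b') (v + n) + a v * b n
  ⊛-exchange v n {a} {b} {b'} a<v≡0 b≡b' = begin
    ((a ⊛ b) (v + n) + a v * b' n) % p   ≡⟨ cong (λ z → (z + a v * b' n) % p) (⊛-def a b (v + n)) ⟩
    (mulS a b (v + n) + a v * b' n) % p  ≡⟨ mulS-exchange v n a b b' a<v≡0 b≡b' ⟩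
    (mulS a b' (v + n) + a v * b n) % p  ≡⟨ cong (λ z → (z + a v * b n) % p) (⊛-def a b' (v + n)) ⟨
    ((a ⊛ b') (v + n) + a v * b n) % p   ∎
    where open ≡-Reasoning

  -- Coefficient j of b is recovered from coefficient v + j of a·b and b_0, …, b_{j−1}.
  ⊛-cancelˡ : ∀ {v a b b'} → HasOrder a v → a ⊛ b ≈ₛ a ⊛ b' → b ≈ₛ b'
  ⊛-cancelˡ {v} {a} {b} {b'} (a<v≡0 , aᵥ≢0) ab≈ab' = mkₛ (<-rec _ step)
    where
    open ≡-Reasoning
    step : ∀ j → (∀ {i} → i < j → b i ≡ₚ b' i) → b j ≡ₚ b' j
    step j b≡b'-below = sym (*-cancelˡₚ pp aᵥ≢0 (+-cancelˡₚ ((a ⊛ b) (v + j)) (begin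
      ((a ⊛ b) (v + j) + a v * b' j) % p   ≡⟨ ⊛-exchange v j a<v≡0 (λ i → b≡b'-below) ⟩
      ((a ⊛ b') (v + j) + a v * b j) % p   ≡⟨ +-congₚ {(a ⊛ b') (v + j)} (sym (at ab≈ab' (v + j))) refl ⟩
      ((a ⊛ b) (v + j) + a v * b j) % p    ∎)))

  least-order : ∀ a i → ¬ (a i ≡ₚ 0) → ∃ (HasOrder a)
  least-order a zero    aᵢ≢0 = 0 , (λ k ()) , aᵢ≢0
  least-order a (suc i) aᵢ≢0 with a 0 % p ≟ 0
  ... | no a₀≢0 = 0 , (λ k ()) , λ a₀≡0 → a₀≢0 (trans a₀≡0 0%p≡0)
  ... | yes a₀≡0 with least-order (tail a) i aᵢ≢0
  ...   | v , tail<v≡0 , tailᵥ≢0 = suc v , below , tailᵥ≢0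
    where
    below : VanishesBelow a (suc v)
    below zero    _       = trans a₀≡0 (sym 0%p≡0)
    below (suc k) k+1<v+1 = tail<v≡0 k (s<s⁻¹ k+1<v+1)

module PolynomialsOverSeries (p : ℕ) (pp : Prime p) where

  private instance
    p-nonZero : NonZero p
    p-nonZero = prime⇒nonZero pp

  open SeriesArithmetic
  open SeriesModP p
  open Order p pp
  module R = CommutativeSemiring seriesSemiring
  open import Algebra.Properties.Semiring.Exp R.semiring using () renaming (_^_ to _^ₛ_)
  open import Algebra.Properties.CommutativeSemigroup R.+-commutativeSemigroup using (interchange)
  open import Algebra.Properties.CommutativeSemigroup R.*-commutativeSemigroup using (x∙yz≈y∙xz)
  open import Relation.Binary.Reasoning.Setoid R.setoid using (begin_; _∎; step-≈-⟩; step-≈-⟨)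

  PolyY : Set
  PolyY = List Series

  infixl 6 _+ʸ_
  infixl 7 _*ʸ_ _·ʸ_

  _+ʸ_ : PolyY → PolyY → PolyY
  []      +ʸ Q       = Q
  (r ∷ P) +ʸ []      = r ∷ P
  (r ∷ P) +ʸ (s ∷ Q) = r ⊕ s ∷ P +ʸ Q

  _·ʸ_ : Series → PolyY → PolyY
  r ·ʸ Q = map (r ⊛_) Q

  _*ʸ_ : PolyY → PolyY → PolyY
  []      *ʸ Q = []
  (r ∷ P) *ʸ Q = r ·ʸ Q +ʸ (zeroS ∷ P *ʸ Q)

  eval : PolyY → Series → Series
  eval []      F = zeroS
  eval (r ∷ P) F = r ⊕ F ⊛ eval P F

  row : PolyY → ℕ → Series
  row []      _       = zeroS
  row (r ∷ P) zero    = r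
  row (r ∷ P) (suc j) = row P j

  row-+ʸ : ∀ P Q j → row (P +ʸ Q) j ≈ₛ row P j ⊕ row Q j
  row-+ʸ []      Q       j       = R.sym (R.+-identityˡ (row Q j))
  row-+ʸ (r ∷ P) []      j       = R.sym (R.+-identityʳ (row (r ∷ P) j))
  row-+ʸ (r ∷ P) (s ∷ Q) zero    = R.refl
  row-+ʸ (r ∷ P) (s ∷ Q) (suc j) = row-+ʸ P Q j

  row-·ʸ : ∀ r Q j → row (r ·ʸ Q) j ≈ₛ r ⊛ row Q j
  row-·ʸ r []      j       = R.sym (R.zeroʳ r)
  row-·ʸ r (s ∷ Q) zero    = R.refl
  row-·ʸ r (s ∷ Q) (suc j) = row-·ʸ r Q j

  row-*ʸ-zero : ∀ r P Q → row ((r ∷ P) *ʸ Q) 0 ≈ₛ r ⊛ row Q 0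
  row-*ʸ-zero r P Q = R.trans (row-+ʸ (r ·ʸ Q) (zeroS ∷ P *ʸ Q) 0) (R.trans (R.+-identityʳ _) (row-·ʸ r Q 0))

  row-*ʸ-suc : ∀ r P Q j → row ((r ∷ P) *ʸ Q) (suc j) ≈ₛ r ⊛ row Q (suc j) ⊕ row (P *ʸ Q) j
  row-*ʸ-suc r P Q j = R.trans (row-+ʸ (r ·ʸ Q) (zeroS ∷ P *ʸ Q) (suc j)) (R.+-congʳ (row-·ʸ r Q (suc j)))

  eval-+ʸ : ∀ P Q F → eval (P +ʸ Q) F ≈ₛ eval P F ⊕ eval Q F
  eval-+ʸ []      Q       F = R.sym (R.+-identityˡ _)
  eval-+ʸ (r ∷ P) []      F = R.sym (R.+-identityʳ _)
  eval-+ʸ (r ∷ P) (s ∷ Q) F = begin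
    (r ⊕ s) ⊕ F ⊛ eval (P +ʸ Q) F                       ≈⟨ R.+-congˡ (R.*-congˡ (eval-+ʸ P Q F)) ⟩
    (r ⊕ s) ⊕ F ⊛ (eval P F ⊕ eval Q F)                 ≈⟨ R.+-congˡ (R.distribˡ F (eval P F) (eval Q F)) ⟩
    (r ⊕ s) ⊕ (F ⊛ eval P F ⊕ F ⊛ eval Q F)             ≈⟨ interchange r s _ _ ⟩
    (r ⊕ F ⊛ eval P F) ⊕ (s ⊕ F ⊛ eval Q F)             ∎

  eval-·ʸ : ∀ r Q F → eval (r ·ʸ Q) F ≈ₛ r ⊛ eval Q F
  eval-·ʸ r []      F = R.sym (R.zeroʳ r)
  eval-·ʸ r (s ∷ Q) F = begin
    r ⊛ s ⊕ F ⊛ eval (r ·ʸ Q) F     ≈⟨ R.+-congˡ (R.*-congˡ (eval-·ʸ r Q F)) ⟩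
    r ⊛ s ⊕ F ⊛ (r ⊛ eval Q F)      ≈⟨ R.+-congˡ (x∙yz≈y∙xz F r (eval Q F)) ⟩
    r ⊛ s ⊕ r ⊛ (F ⊛ eval Q F)      ≈⟨ R.distribˡ r s _ ⟨
    r ⊛ (s ⊕ F ⊛ eval Q F)          ∎

  eval-*ʸ : ∀ P Q F → eval (P *ʸ Q) F ≈ₛ eval P F ⊛ eval Q F
  eval-*ʸ []      Q F = R.sym (R.zeroˡ (eval Q F))
  eval-*ʸ (r ∷ P) Q F = begin
    eval (r ·ʸ Q +ʸ (zeroS ∷ P *ʸ Q)) F               ≈⟨ eval-+ʸ (r ·ʸ Q) (zeroS ∷ P *ʸ Q) F ⟩
    eval (r ·ʸ Q) F ⊕ (zeroS ⊕ F ⊛ eval (P *ʸ Q) F)   ≈⟨ R.+-cong (eval-·ʸ r Q F) (R.+-identityˡ _) ⟩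
    r ⊛ eval Q F ⊕ F ⊛ eval (P *ʸ Q) F                ≈⟨ R.+-congˡ (R.*-congˡ (eval-*ʸ P Q F)) ⟩
    r ⊛ eval Q F ⊕ F ⊛ (eval P F ⊛ eval Q F)          ≈⟨ R.+-congˡ (R.*-assoc F (eval P F) (eval Q F)) ⟨
    r ⊛ eval Q F ⊕ F ⊛ eval P F ⊛ eval Q F            ≈⟨ R.distribʳ (eval Q F) r _ ⟨
    (r ⊕ F ⊛ eval P F) ⊛ eval Q F                     ∎

  IsZeroʸ : PolyY → Set
  IsZeroʸ P = ∀ j → row P j ≈ₛ zeroS

  eval-IsZeroʸ : ∀ P F → IsZeroʸ P → eval P F ≈ₛ zeroS
  eval-IsZeroʸ []      F _     = R.refl
  eval-IsZeroʸ (r ∷ P) F P≈0 = begin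
    r ⊕ F ⊛ eval P F     ≈⟨ R.+-cong (P≈0 0) (R.*-congˡ (eval-IsZeroʸ P F (P≈0 ∘ suc))) ⟩
    zeroS ⊕ F ⊛ zeroS    ≈⟨ R.+-identityˡ _ ⟩
    F ⊛ zeroS            ≈⟨ R.zeroʳ F ⟩
    zeroS                ∎

  eval-cong-rows : ∀ P Q F → (∀ j → row P j ≈ₛ row Q j) → eval P F ≈ₛ eval Q F
  eval-cong-rows []      []      F _   = R.refl
  eval-cong-rows []      (s ∷ Q) F P≈Q = R.sym (eval-IsZeroʸ (s ∷ Q) F (R.sym ∘ P≈Q))
  eval-cong-rows (r ∷ P) []      F P≈Q = eval-IsZeroʸ (r ∷ P) F P≈Q
  eval-cong-rows (r ∷ P) (s ∷ Q) F P≈Q = R.+-cong (P≈Q 0) (R.*-congˡ (eval-cong-rows P Q F (P≈Q ∘ suc)))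

  *ʸ-IsZeroʸ : ∀ P Q → IsZeroʸ P → IsZeroʸ (P *ʸ Q)
  *ʸ-IsZeroʸ []      Q _   j       = R.refl
  *ʸ-IsZeroʸ (r ∷ P) Q P≈0 zero    = R.trans (row-*ʸ-zero r P Q) (R.trans (R.*-congʳ (P≈0 0)) (R.zeroˡ _))
  *ʸ-IsZeroʸ (r ∷ P) Q P≈0 (suc j) = begin
    row ((r ∷ P) *ʸ Q) (suc j)          ≈⟨ row-*ʸ-suc r P Q j ⟩
    r ⊛ row Q (suc j) ⊕ row (P *ʸ Q) j  ≈⟨ R.+-cong (R.trans (R.*-congʳ (P≈0 0)) (R.zeroˡ _)) (*ʸ-IsZeroʸ P Q (P≈0 ∘ suc) j) ⟩
    zeroS ⊕ zeroS                        ≈⟨ R.+-identityˡ zeroS ⟩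
    zeroS                                ∎

  DegY≤ : PolyY → ℕ → Set
  DegY≤ P δ = ∀ j → δ < j → row P j ≈ₛ zeroS

  DegX≤ : PolyY → ℕ → Set
  DegX≤ P α = ∀ j → VanishesAbove (row P j) α

  DegY≤-weaken : ∀ {P δ δ'} → δ ≤ δ' → DegY≤ P δ → DegY≤ P δ'
  DegY≤-weaken δ≤δ' P≤δ j δ'<j = P≤δ j (≤-<-trans δ≤δ' δ'<j)

  DegY≤-+ʸ : ∀ P Q {δ} → DegY≤ P δ → DegY≤ Q δ → DegY≤ (P +ʸ Q) δ
  DegY≤-+ʸ P Q P≤δ Q≤δ j δ<j = R.trans (row-+ʸ P Q j) (R.trans (R.+-cong (P≤δ j δ<j) (Q≤δ j δ<j)) (R.+-identityˡ zeroS))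

  DegY≤-·ʸ : ∀ r Q {δ} → DegY≤ Q δ → DegY≤ (r ·ʸ Q) δ
  DegY≤-·ʸ r Q Q≤δ j δ<j = R.trans (row-·ʸ r Q j) (R.trans (R.*-congˡ (Q≤δ j δ<j)) (R.zeroʳ r))

  DegY≤-*ʸ : ∀ P Q δ₁ δ₂ → DegY≤ P δ₁ → DegY≤ Q δ₂ → DegY≤ (P *ʸ Q) (δ₁ + δ₂)
  DegY≤-*ʸ []      Q δ₁ δ₂ _ _ j _ = R.refl
  DegY≤-*ʸ (r ∷ P) Q δ₁ δ₂ P≤δ₁ Q≤δ₂ (suc j) δ<j+1 = begin
    row ((r ∷ P) *ʸ Q) (suc j)          ≈⟨ row-*ʸ-suc r P Q j ⟩
    r ⊛ row Q (suc j) ⊕ row (P *ʸ Q) j  ≈⟨ R.+-cong (R.trans (R.*-congˡ (Q≤δ₂ (suc j) δ₂<j+1)) (R.zeroʳ r)) (lower δ₁ P≤δ₁ δ<j+1) ⟩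
    zeroS ⊕ zeroS                        ≈⟨ R.+-identityˡ zeroS ⟩
    zeroS                                ∎
    where
    δ₂<j+1 : δ₂ < suc j
    δ₂<j+1 = ≤-<-trans (m≤n+m δ₂ δ₁) δ<j+1
    lower : ∀ δ₁ → DegY≤ (r ∷ P) δ₁ → δ₁ + δ₂ < suc j → row (P *ʸ Q) j ≈ₛ zeroS
    lower zero     P≤0    _         = *ʸ-IsZeroʸ P Q (λ i → P≤0 (suc i) z<s) j
    lower (suc δ₁) P≤δ₁+1 δ₁+δ₂<j+1 = DegY≤-*ʸ P Q δ₁ δ₂ (λ i δ₁<i → P≤δ₁+1 (suc i) (s<s δ₁<i)) Q≤δ₂ j (s<s⁻¹ δ₁+δ₂<j+1)

  DegX≤-+ʸ : ∀ P Q {α} → DegX≤ P α → DegX≤ Q α → DegX≤ (P +ʸ Q) α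
  DegX≤-+ʸ P Q P≤α Q≤α j = VanishesAbove-≈ₛ (row-+ʸ P Q j) (⊕-vanishes-above (P≤α j) (Q≤α j))

  DegX≤-·ʸ : ∀ r Q α β → VanishesAbove r α → DegX≤ Q β → DegX≤ (r ·ʸ Q) (α + β)
  DegX≤-·ʸ r Q α β r>α≡0 Q≤β j = VanishesAbove-≈ₛ (row-·ʸ r Q j) (⊛-vanishes-above α β r>α≡0 (Q≤β j))

  DegX≤-*ʸ : ∀ P Q α β → DegX≤ P α → DegX≤ Q β → DegX≤ (P *ʸ Q) (α + β)
  DegX≤-*ʸ []      Q α β _   _   j       k _ = refl
  DegX≤-*ʸ (r ∷ P) Q α β P≤α Q≤β zero    =
    VanishesAbove-≈ₛ (row-*ʸ-zero r P Q) (⊛-vanishes-above α β (P≤α 0) (Q≤β 0))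
  DegX≤-*ʸ (r ∷ P) Q α β P≤α Q≤β (suc j) = VanishesAbove-≈ₛ (row-*ʸ-suc r P Q j)
    (⊕-vanishes-above (⊛-vanishes-above α β (P≤α 0) (Q≤β (suc j))) (DegX≤-*ʸ P Q α β (P≤α ∘ suc) Q≤β j))

  -- The top row of P·Q, at y-degree d + l, is P_d·Q_l plus terms involving only the rows of Q above l.
  row-*ʸ-exchange : ∀ d l P Q Q' → DegY≤ P d → (∀ l' → l < l' → row Q l' ≈ₛ row Q' l') →
    row (P *ʸ Q) (d + l) ⊕ row P d ⊛ row Q' l ≈ₛ row (P *ʸ Q') (d + l) ⊕ row P d ⊛ row Q l
  row-*ʸ-exchange d l [] Q Q' _ _ = R.+-congˡ (R.trans (R.zeroˡ _) (R.sym (R.zeroˡ _)))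
  row-*ʸ-exchange zero l (r ∷ P) Q Q' P≤0 _ = begin
    row ((r ∷ P) *ʸ Q) l ⊕ r ⊛ row Q' l    ≈⟨ R.+-congʳ (bottom Q l) ⟩
    r ⊛ row Q l ⊕ r ⊛ row Q' l              ≈⟨ R.+-comm _ _ ⟩
    r ⊛ row Q' l ⊕ r ⊛ row Q l              ≈⟨ R.+-congʳ (bottom Q' l) ⟨
    row ((r ∷ P) *ʸ Q') l ⊕ r ⊛ row Q l    ∎
    where
    bottom : ∀ X j → row ((r ∷ P) *ʸ X) j ≈ₛ r ⊛ row X j
    bottom X zero    = row-*ʸ-zero r P X
    bottom X (suc j) = R.trans (row-*ʸ-suc r P X j) (R.trans (R.+-congˡ (*ʸ-IsZeroʸ P X (λ i → P≤0 (suc i) z<s) j)) (R.+-identityʳ _))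
  row-*ʸ-exchange (suc d) l (r ∷ P) Q Q' P≤d+1 Q≈Q'-above = begin
    row ((r ∷ P) *ʸ Q) (suc (d + l)) ⊕ row P d ⊛ row Q' l                 ≈⟨ R.+-congʳ (row-*ʸ-suc r P Q (d + l)) ⟩
    (r ⊛ row Q (suc (d + l)) ⊕ row (P *ʸ Q) (d + l)) ⊕ row P d ⊛ row Q' l ≈⟨ R.+-assoc _ _ _ ⟩
    r ⊛ row Q (suc (d + l)) ⊕ (row (P *ʸ Q) (d + l) ⊕ row P d ⊛ row Q' l) ≈⟨ R.+-cong (R.*-congˡ (Q≈Q'-above (suc (d + l)) (s≤s (m≤n+m l d))))
                                                                                       (row-*ʸ-exchange d l P Q Q' (λ j d<j → P≤d+1 (suc j) (s<s d<j)) Q≈Q'-above) ⟩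
    r ⊛ row Q' (suc (d + l)) ⊕ (row (P *ʸ Q') (d + l) ⊕ row P d ⊛ row Q l) ≈⟨ R.+-assoc _ _ _ ⟨
    (r ⊛ row Q' (suc (d + l)) ⊕ row (P *ʸ Q') (d + l)) ⊕ row P d ⊛ row Q l ≈⟨ R.+-congʳ (row-*ʸ-suc r P Q' (d + l)) ⟨
    row ((r ∷ P) *ʸ Q') (suc (d + l)) ⊕ row P d ⊛ row Q l                 ∎

  *ʸ-cancelˡ : ∀ d δ P {Q Q' v} → DegY≤ P d → HasOrder (row P d) v → DegY≤ Q δ → DegY≤ Q' δ →
    (∀ j → row (P *ʸ Q) j ≈ₛ row (P *ʸ Q') j) → ∀ l → row Q l ≈ₛ row Q' l
  *ʸ-cancelˡ d δ P {Q} {Q'} P≤d Pd-order Q≤δ Q'≤δ PQ≈PQ' l = downFrom (suc δ) l (m≤m+n (suc δ) l)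
    where
    downFrom : ∀ t l → δ < t + l → row Q l ≈ₛ row Q' l
    downFrom zero    l δ<l     = R.trans (Q≤δ l δ<l) (R.sym (Q'≤δ l δ<l))
    downFrom (suc t) l δ<t+1+l =
      R.sym (⊛-cancelˡ Pd-order (⊕-cancelˡ (row-*ʸ-exchange d l P Q Q' P≤d above) (PQ≈PQ' (d + l))))
      where
      above : ∀ l' → l < l' → row Q l' ≈ₛ row Q' l'
      above l' l<l' = downFrom t l' (≤-trans δ<t+1+l (≤-trans (≤-reflexive (sym (+-suc t l))) (+-monoʳ-≤ t l<l')))

  monomial : ℕ → Series → PolyY
  monomial zero    r = r ∷ []
  monomial (suc k) r = zeroS ∷ monomial k r

  eval-monomial : ∀ k r F → eval (monomial k r) F ≈ₛ r ⊛ F ^ₛ k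
  eval-monomial zero    r F = R.trans (R.+-congˡ (R.zeroʳ F)) (R.trans (R.+-identityʳ r) (R.sym (R.*-identityʳ r)))
  eval-monomial (suc k) r F = begin
    zeroS ⊕ F ⊛ eval (monomial k r) F   ≈⟨ R.+-identityˡ _ ⟩
    F ⊛ eval (monomial k r) F           ≈⟨ R.*-congˡ (eval-monomial k r F) ⟩
    F ⊛ (r ⊛ F ^ₛ k)                    ≈⟨ x∙yz≈y∙xz F r (F ^ₛ k) ⟩
    r ⊛ (F ⊛ F ^ₛ k)                    ∎

  row-monomial-cong : ∀ k {r r'} → r ≈ₛ r' → ∀ j → row (monomial k r) j ≈ₛ row (monomial k r') j
  row-monomial-cong zero    r≈r' zero    = r≈r'
  row-monomial-cong zero    r≈r' (suc j) = R.refl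
  row-monomial-cong (suc k) r≈r' zero    = R.refl
  row-monomial-cong (suc k) r≈r' (suc j) = row-monomial-cong k r≈r' j

  DegY≤-monomial : ∀ k r → DegY≤ (monomial k r) k
  DegY≤-monomial zero    r (suc j) _       = R.refl
  DegY≤-monomial (suc k) r (suc j) k+1<j+1 = DegY≤-monomial k r j (s<s⁻¹ k+1<j+1)

  DegX≤-monomial : ∀ k {r α} → VanishesAbove r α → DegX≤ (monomial k r) α
  DegX≤-monomial zero    r>α≡0 zero    = r>α≡0
  DegX≤-monomial zero    r>α≡0 (suc j) _ _ = refl
  DegX≤-monomial (suc k) r>α≡0 zero    _ _ = refl
  DegX≤-monomial (suc k) r>α≡0 (suc j) = DegX≤-monomial k r>α≡0 j

  toPolyY : Poly2 p → PolyY
  toPolyY E = map lookupD E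

  evalS≗eval : ∀ E F → evalS E F ≗ eval (toPolyY E) F
  evalS≗eval []      F n = refl
  evalS≗eval (r ∷ E) F n = begin-≡
    lookupD r n + mulS F (evalS E F) n                  ≡⟨ cong (lookupD r n +_) (mulS-cong {a = F} (λ _ → refl) (evalS≗eval E F) n) ⟩
    lookupD r n + mulS F (eval (toPolyY E) F) n         ≡⟨ cong (lookupD r n +_) (⊛-def F (eval (toPolyY E) F) n) ⟨
    lookupD r n + (F ⊛ eval (toPolyY E) F) n            ≡⟨ ⊕-def (lookupD r) (F ⊛ eval (toPolyY E) F) n ⟨
    (lookupD r ⊕ F ⊛ eval (toPolyY E) F) n              ∎-≡
    where open ≡-Reasoning renaming (begin_ to begin-≡_; _∎ to _∎-≡)

  row-toPolyY : ∀ E j k → row (toPolyY E) j k ≡ coeff E k j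
  row-toPolyY []      j       k = refl
  row-toPolyY (r ∷ E) zero    k = refl
  row-toPolyY (r ∷ E) (suc j) k = row-toPolyY E j k

  lookupD<p : ∀ (r : List (Fin p)) i → lookupD r i < p
  lookupD<p []      i       = >-nonZero⁻¹ p
  lookupD<p (a ∷ r) zero    = toℕ<n a
  lookupD<p (a ∷ r) (suc i) = lookupD<p r i

  coeff<p : ∀ (E : Poly2 p) i j → coeff E i j < p
  coeff<p []      i j       = >-nonZero⁻¹ p
  coeff<p (r ∷ E) i zero    = lookupD<p r i
  coeff<p (r ∷ E) i (suc j) = coeff<p E i j

  row-tabulate : ∀ {n} (g : Fin n → Series) j → row (tabulate g) j ≡ extend zeroS g j
  row-tabulate {zero}  g j       = refl
  row-tabulate {suc n} g zero    = refl
  row-tabulate {suc n} g (suc j) = row-tabulate (g ∘ Fin.suc) j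

module LinearizedPolynomials (p : ℕ) (pp : Prime p) where

  private instance
    p-nonZero : NonZero p
    p-nonZero = prime⇒nonZero pp

  open Congruence p
  open SeriesArithmetic
  open SeriesModP p
  open Order p pp
  open PolynomialsOverSeries p pp
  open import Algebra.Properties.Semiring.Exp R.semiring using () renaming (_^_ to _^ₛ_)
  open import Algebra.Properties.CommutativeSemigroup R.+-commutativeSemigroup using (interchange)
  open Frobenius seriesSemiring using ([x+y]^[p^i]≈x^[p^i]+y^[p^i])
  open PrimeBinomial using (prime>1)
  open import Relation.Binary.Reasoning.Setoid R.setoid using (begin_; _∎; step-≈-⟩; step-≈-⟨)

  linearized : (ℕ → Series) → ℕ → PolyY
  linearized c zero    = []
  linearized c (suc i) = monomial (p ^ i) (c i) +ʸ linearized c i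

  linearizedAt : (ℕ → Series) → Series → ℕ → Series
  linearizedAt c F zero    = zeroS
  linearizedAt c F (suc i) = c i ⊛ F ^ₛ (p ^ i) ⊕ linearizedAt c F i

  eval-linearized : ∀ c F K → eval (linearized c K) F ≈ₛ linearizedAt c F K
  eval-linearized c F zero    = R.refl
  eval-linearized c F (suc K) = R.trans (eval-+ʸ (monomial (p ^ K) (c K)) (linearized c K) F)
                                        (R.+-cong (eval-monomial (p ^ K) (c K) F) (eval-linearized c F K))

  row-linearized-cong : ∀ {c c'} K → (∀ i → i < K → c i ≈ₛ c' i) → ∀ j → row (linearized c K) j ≈ₛ row (linearized c' K) j
  row-linearized-cong zero    c≈c' j = R.refl
  row-linearized-cong {c} {c'} (suc K) c≈c' j = begin
    row (monomial (p ^ K) (c K) +ʸ linearized c K) j          ≈⟨ row-+ʸ (monomial (p ^ K) (c K)) (linearized c K) j ⟩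
    row (monomial (p ^ K) (c K)) j ⊕ row (linearized c K) j   ≈⟨ R.+-cong (row-monomial-cong (p ^ K) (c≈c' K ≤-refl) j)
                                                                          (row-linearized-cong K (λ i i<K → c≈c' i (m<n⇒m<1+n i<K)) j) ⟩
    row (monomial (p ^ K) (c' K)) j ⊕ row (linearized c' K) j ≈⟨ row-+ʸ (monomial (p ^ K) (c' K)) (linearized c' K) j ⟨
    row (monomial (p ^ K) (c' K) +ʸ linearized c' K) j        ∎

  linearizedAt-cong : ∀ {c c'} F K → (∀ i → i < K → c i ≈ₛ c' i) → linearizedAt c F K ≈ₛ linearizedAt c' F K
  linearizedAt-cong F zero    c≈c' = R.refl
  linearizedAt-cong F (suc K) c≈c' =
    R.+-cong (R.*-congʳ (c≈c' K ≤-refl)) (linearizedAt-cong F K (λ i i<K → c≈c' i (m<n⇒m<1+n i<K)))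

  DegY≤-linearized : ∀ c K → DegY≤ (linearized c (suc K)) (p ^ K)
  DegY≤-linearized c zero = DegY≤-+ʸ (monomial 1 (c 0)) [] (DegY≤-monomial (p ^ 0) (c 0)) (λ j _ → R.refl)
  DegY≤-linearized c (suc K) = DegY≤-+ʸ (monomial (p ^ suc K) (c (suc K))) (linearized c (suc K))
    (DegY≤-monomial (p ^ suc K) (c (suc K)))
    (DegY≤-weaken {linearized c (suc K)} (^-monoʳ-≤ p (n≤1+n K)) (DegY≤-linearized c K))

  DegX≤-linearized : ∀ c K {α} → (∀ i → VanishesAbove (c i) α) → DegX≤ (linearized c K) α
  DegX≤-linearized c zero    c≤α j k _ = refl
  DegX≤-linearized c (suc K) c≤α =
    DegX≤-+ʸ (monomial (p ^ K) (c K)) (linearized c K) (DegX≤-monomial (p ^ K) (c≤α K)) (DegX≤-linearized c K c≤α)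

  linearizedAt-additive : ∀ c {F G H} K → F ≈ₛ G ⊕ H → linearizedAt c F K ≈ₛ linearizedAt c G K ⊕ linearizedAt c H K
  linearizedAt-additive c zero F≈G+H = R.sym (R.+-identityˡ zeroS)
  linearizedAt-additive c {F} {G} {H} (suc K) F≈G+H = begin
    c K ⊛ F ^ₛ (p ^ K) ⊕ linearizedAt c F K
      ≈⟨ R.+-cong (R.*-congˡ (R.trans (^-congˡ (p ^ K) F≈G+H) ([x+y]^[p^i]≈x^[p^i]+y^[p^i] pp p·1≈0 K G H)))
                  (linearizedAt-additive c K F≈G+H) ⟩
    c K ⊛ (G ^ₛ (p ^ K) ⊕ H ^ₛ (p ^ K)) ⊕ (linearizedAt c G K ⊕ linearizedAt c H K)
      ≈⟨ R.+-congʳ (R.distribˡ (c K) _ _) ⟩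
    (c K ⊛ G ^ₛ (p ^ K) ⊕ c K ⊛ H ^ₛ (p ^ K)) ⊕ (linearizedAt c G K ⊕ linearizedAt c H K)
      ≈⟨ interchange _ _ _ _ ⟩
    (c K ⊛ G ^ₛ (p ^ K) ⊕ linearizedAt c G K) ⊕ (c K ⊛ H ^ₛ (p ^ K) ⊕ linearizedAt c H K) ∎
    where open import Algebra.Properties.Semiring.Exp R.semiring using (^-congˡ)

  module _ {H n} (H-order : HasOrder H n) where

    private
      Hᵖ : ℕ → Series
      Hᵖ i = H ^ₛ (p ^ i)

      Hᵖ-order : ∀ i → HasOrder (Hᵖ i) (p ^ i * n)
      Hᵖ-order i = HasOrder-^ H-order (p ^ i)

    linearizedAt-truncate : ∀ c {i a} K → i < K → a < n →
      linearizedAt c H K (p ^ i * n + a) ≡ₚ linearizedAt c H (suc i) (p ^ i * n + a)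
    linearizedAt-truncate c {i} {a} (suc K) i<K+1 a<n with m≤n⇒m<n∨m≡n (s≤s⁻¹ i<K+1)
    ... | inj₂ refl = refl
    ... | inj₁ i<K  = trans (cong (_% p) (⊕-def (c K ⊛ Hᵖ K) (linearizedAt c H K) N))
                            (+-congₚ {(c K ⊛ Hᵖ K) N} {0} beyond (linearizedAt-truncate c K i<K a<n))
      where
      N = p ^ i * n + a
      beyond : (c K ⊛ Hᵖ K) N ≡ₚ 0
      beyond = trans (cong (_% p) (⊛-def (c K) (Hᵖ K) N))
        (mulS-vanishes-below 0 (p ^ K * n) (c K) (Hᵖ K) (λ _ ()) (proj₁ (Hᵖ-order K)) N (b^i*n+a<b^K*n (prime>1 pp) i<K a<n))

    -- When ord H exceeds the x-degrees of the c_i, the terms c_i H^{p^i} start at the distinct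
    -- x-degrees p^i·ord H and their lowest ord H coefficients do not interfere.
    linearizedAt-injective : ∀ {D c c'} K → D < n → (∀ i → VanishesAbove (c i) D) → (∀ i → VanishesAbove (c' i) D) →
      linearizedAt c H K ≈ₛ linearizedAt c' H K → ∀ i → i < K → c i ≈ₛ c' i
    linearizedAt-injective {D} {c} {c'} K D<n c≤D c'≤D L≈L' =
      <-rec _ λ i c≈c'-below i<K → mkₛ (<-rec _ (coefficient i c≈c'-below i<K))
      where
      coefficient : ∀ i → (∀ {i'} → i' < i → i' < K → c i' ≈ₛ c' i') → i < K →
        ∀ a → (∀ {a'} → a' < a → c i a' ≡ₚ c' i a') → c i a ≡ₚ c' i a
      coefficient i c≈c'-below i<K a cᵢ≡c'ᵢ-below with a ≤? D
      ... | no a≰D  = trans (c≤D i a (≰⇒> a≰D)) (sym (c'≤D i a (≰⇒> a≰D)))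
      ... | yes a≤D = sym (*-cancelˡₚ pp (proj₂ (Hᵖ-order i))
                            (+-cancelˡₚ ((c i ⊛ Hᵖ i) N) (trans exchange (+-congₚ {(c' i ⊛ Hᵖ i) N} (sym terms≡) refl))))
        where
        N = p ^ i * n + a
        L = Hᵖ i (p ^ i * n)
        a<n = ≤-<-trans a≤D D<n
        exchange : (c i ⊛ Hᵖ i) N + L * c' i a ≡ₚ (c' i ⊛ Hᵖ i) N + L * c i a
        exchange = trans (+-congₚ {(c i ⊛ Hᵖ i) N} (at (R.*-comm (c i) (Hᵖ i)) N) refl)
                  (trans (⊛-exchange (p ^ i * n) a (proj₁ (Hᵖ-order i)) (λ j j<a → cᵢ≡c'ᵢ-below j<a))
                         (+-congₚ {(Hᵖ i ⊛ c' i) N} (at (R.*-comm (Hᵖ i) (c' i)) N) refl))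
        terms≡ : (c i ⊛ Hᵖ i) N ≡ₚ (c' i ⊛ Hᵖ i) N
        terms≡ = ⊕-cancelʳ-at N
          (trans (sym (linearizedAt-truncate c K i<K a<n)) (trans (at L≈L' N) (linearizedAt-truncate c' K i<K a<n)))
          (at (linearizedAt-cong H i λ i' i'<i → c≈c'-below i'<i (<-trans i'<i i<K)) N)

module Counting (p : ℕ) (pp : Prime p) (E : Poly2 p) (d m : ℕ) (E-degY : DegY E d) (E-degX : DegX E m) where

  private instance
    p-nonZero : NonZero p
    p-nonZero = prime⇒nonZero pp

  open Congruence p
  open SeriesArithmetic
  open SeriesModP p
  open Order p pp
  open PolynomialsOverSeries p pp
  open LinearizedPolynomials p pp
  open PrimeBinomial using (prime>1)
  open import Relation.Binary.Reasoning.Setoid R.setoid using (begin_; _∎; step-≈-⟩; step-≈-⟨)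

  δQ DQ D : ℕ
  δQ = p ^ d ∸ d
  DQ = δQ * m
  D  = (δQ + 1) * m

  #c #Q #T : ℕ
  #c = suc d * suc D
  #Q = suc δQ * suc DQ
  #T = suc D * suc (p ^ d)

  -- A choice lists the coefficients of c_0, …, c_d (x-degree ≤ D) and of Q (y-degree ≤ δQ, x-degree ≤ DQ).
  Choice : Set
  Choice = Fin (#c + #Q) → Fin p

  cEntry : Choice → Fin (suc d) → Fin (suc D) → ℕ
  cEntry w i a = toℕ (w (combine i a ↑ˡ #Q))

  QEntry : Choice → Fin (suc δQ) → Fin (suc DQ) → ℕ
  QEntry w l a = toℕ (w (#c ↑ʳ combine l a))

  cRow : Choice → Fin (suc d) → Series
  cRow w i = extend 0 (cEntry w i)

  QRow : Choice → Fin (suc δQ) → Series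
  QRow w l = extend 0 (QEntry w l)

  c⟨_⟩ : Choice → ℕ → Series
  c⟨ w ⟩ = extend zeroS (cRow w)

  Q⟨_⟩ : Choice → PolyY
  Q⟨ w ⟩ = tabulate (QRow w)

  Eʸ : PolyY
  Eʸ = toPolyY E

  -- L_c − E·Q, with −1 represented by p − 1.
  T⟨_⟩ : Choice → PolyY
  T⟨ w ⟩ = linearized c⟨ w ⟩ (suc d) +ʸ constant (p ∸ 1) ·ʸ (Eʸ *ʸ Q⟨ w ⟩)

  c⟨⟩-at : ∀ w i a → c⟨ w ⟩ (toℕ i) (toℕ a) ≡ toℕ (w (combine i a ↑ˡ #Q))
  c⟨⟩-at w i a = trans (cong (λ r → r (toℕ a)) (extend-toℕ zeroS (cRow w) i)) (extend-toℕ 0 (cEntry w i) a)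

  Q⟨⟩-at : ∀ w l a → row Q⟨ w ⟩ (toℕ l) (toℕ a) ≡ toℕ (w (#c ↑ʳ combine l a))
  Q⟨⟩-at w l a = trans (cong (λ r → r (toℕ a)) (trans (row-tabulate (QRow w) (toℕ l)) (extend-toℕ zeroS (QRow w) l)))
                       (extend-toℕ 0 (QEntry w l) a)

  Eʸ-degY : DegY≤ Eʸ d
  Eʸ-degY j d<j = mkₛ λ k → cong (_% p) (trans (row-toPolyY E j k) (proj₂ E-degY k j d<j))

  Eʸ-degX : DegX≤ Eʸ m
  Eʸ-degX j k m<k = cong (_% p) (trans (row-toPolyY E j k) (proj₂ E-degX k j m<k))

  Eʸ-leading : ∃ (HasOrder (row Eʸ d))
  Eʸ-leading with proj₁ E-degY
  ... | i , Eid≢0 = least-order (row Eʸ d) i λ Eid≡ₚ0 →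
    Eid≢0 (trans (sym (m<n⇒m%n≡m (coeff<p E i d))) (trans (subst (λ z → z % p ≡ 0 % p) (row-toPolyY E d i) Eid≡ₚ0) 0%p≡0))

  Q-degY : ∀ w → DegY≤ Q⟨ w ⟩ δQ
  Q-degY w j δQ<j = R.reflexive (trans (row-tabulate (QRow w) j) (extend-≥ zeroS (QRow w) j δQ<j))

  Q-degX : ∀ w → DegX≤ Q⟨ w ⟩ DQ
  Q-degX w j k DQ<k = cong (_% p) (trans (cong (λ r → r k) (row-tabulate (QRow w) j))
    (extend-all (λ r → r k ≡ 0) {g = QRow w} refl (λ l → extend-≥ 0 (QEntry w l) k DQ<k) j))

  c-degX : ∀ w i → VanishesAbove (c⟨ w ⟩ i) D
  c-degX w i k D<k = cong (_% p) (extend-all (λ r → r k ≡ 0) {g = cRow w} refl (λ i → extend-≥ 0 (cEntry w i) k D<k) i)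

  T-degY : ∀ w → DegY≤ T⟨ w ⟩ (p ^ d)
  T-degY w = DegY≤-+ʸ (linearized c⟨ w ⟩ (suc d)) (constant (p ∸ 1) ·ʸ (Eʸ *ʸ Q⟨ w ⟩)) (DegY≤-linearized c⟨ w ⟩ d)
    (DegY≤-·ʸ (constant (p ∸ 1)) (Eʸ *ʸ Q⟨ w ⟩) (subst (DegY≤ (Eʸ *ʸ Q⟨ w ⟩)) d+δQ≡p^d (DegY≤-*ʸ Eʸ Q⟨ w ⟩ d δQ Eʸ-degY (Q-degY w))))
    where
    d+δQ≡p^d : d + δQ ≡ p ^ d
    d+δQ≡p^d = trans (+-comm d δQ) (m∸n+n≡m (<⇒≤ (n<b^n (prime>1 pp) d)))

  T-degX : ∀ w → DegX≤ T⟨ w ⟩ D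
  T-degX w = DegX≤-+ʸ (linearized c⟨ w ⟩ (suc d)) (constant (p ∸ 1) ·ʸ (Eʸ *ʸ Q⟨ w ⟩)) (DegX≤-linearized c⟨ w ⟩ (suc d) (c-degX w))
    (subst (DegX≤ (constant (p ∸ 1) ·ʸ (Eʸ *ʸ Q⟨ w ⟩))) (m+DQ≡D δQ m) (DegX≤-·ʸ (constant (p ∸ 1)) (Eʸ *ʸ Q⟨ w ⟩) 0 (m + DQ) constant>0 (DegX≤-*ʸ Eʸ Q⟨ w ⟩ m DQ Eʸ-degX (Q-degX w))))
    where
    constant>0 : VanishesAbove (constant (p ∸ 1)) 0
    constant>0 (suc k) _ = refl
    m+DQ≡D : ∀ (δ m : ℕ) → m + δ * m ≡ (δ + 1) * m
    m+DQ≡D = solve-∀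

  coefficientAt : Choice → Fin (suc D) × Fin (suc (p ^ d)) → Fin p
  coefficientAt w (a , j) = row T⟨ w ⟩ (toℕ j) (toℕ a) mod p

  -- The coefficients of x^a y^j (a ≤ D, j ≤ p^d) of T⟨ w ⟩; by T-degX and T-degY they determine it.
  coefficients : Choice → Fin #T → Fin p
  coefficients w = coefficientAt w ∘ remQuot (suc (p ^ d))

  coefficients-rows : ∀ w w' → coefficients w ≗ coefficients w' → ∀ j → row T⟨ w ⟩ j ≈ₛ row T⟨ w' ⟩ j
  coefficients-rows w w' same j = mkₛ cell
    where
    cell : ∀ a → row T⟨ w ⟩ j a ≡ₚ row T⟨ w' ⟩ j a
    cell a with a ≤? D | j ≤? p ^ d
    ... | no a≰D | _      = trans (T-degX w j a (≰⇒> a≰D)) (sym (T-degX w' j a (≰⇒> a≰D)))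
    ... | yes _  | no j≰  = trans (at (T-degY w j (≰⇒> j≰)) a) (sym (at (T-degY w' j (≰⇒> j≰)) a))
    ... | yes a≤D | yes j≤ = subst₂ (λ a j → row T⟨ w ⟩ j a % p ≡ row T⟨ w' ⟩ j a % p) (toℕ-fromℕ< (s≤s a≤D)) (toℕ-fromℕ< (s≤s j≤))
      (trans (sym (toℕ-coefficientAt w)) (trans (cong toℕ (coefficientAt-same)) (toℕ-coefficientAt w')))
      where
      â : Fin (suc D)
      â = fromℕ< (s≤s a≤D)
      ĵ : Fin (suc (p ^ d))
      ĵ = fromℕ< (s≤s j≤)
      toℕ-coefficientAt : ∀ v → toℕ (coefficientAt v (â , ĵ)) ≡ row T⟨ v ⟩ (toℕ ĵ) (toℕ â) % p
      toℕ-coefficientAt v = toℕ-fromℕ< _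
      coefficientAt-same : coefficientAt w (â , ĵ) ≡ coefficientAt w' (â , ĵ)
      coefficientAt-same = subst (λ x → coefficientAt w x ≡ coefficientAt w' x) (remQuot-combine â ĵ) (same (combine â ĵ))

  root⇒eval≈0 : ∀ {f} → IsRoot E f → eval Eʸ (liftS f) ≈ₛ zeroS
  root⇒eval≈0 {f} f-root = mkₛ λ n → trans (cong (_% p) (sym (evalS≗eval E (liftS f) n))) (∣⇒≡ₚ0 (f-root n))

  eval-T : ∀ w {F} → eval Eʸ F ≈ₛ zeroS → eval T⟨ w ⟩ F ≈ₛ linearizedAt c⟨ w ⟩ F (suc d)
  eval-T w {F} E[F]≈0 = begin
    eval T⟨ w ⟩ F                                                  ≈⟨ eval-+ʸ (linearized c⟨ w ⟩ (suc d)) (constant (p ∸ 1) ·ʸ (Eʸ *ʸ Q⟨ w ⟩)) F ⟩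
    eval (linearized c⟨ w ⟩ (suc d)) F ⊕ eval (constant (p ∸ 1) ·ʸ (Eʸ *ʸ Q⟨ w ⟩)) F
                                                                   ≈⟨ R.+-cong (eval-linearized c⟨ w ⟩ F (suc d)) (eval-·ʸ (constant (p ∸ 1)) (Eʸ *ʸ Q⟨ w ⟩) F) ⟩
    linearizedAt c⟨ w ⟩ F (suc d) ⊕ constant (p ∸ 1) ⊛ eval (Eʸ *ʸ Q⟨ w ⟩) F
                                                                   ≈⟨ R.+-congˡ (R.*-congˡ (eval-*ʸ Eʸ Q⟨ w ⟩ F)) ⟩
    linearizedAt c⟨ w ⟩ F (suc d) ⊕ constant (p ∸ 1) ⊛ (eval Eʸ F ⊛ eval Q⟨ w ⟩ F)
                                                                   ≈⟨ R.+-congˡ (R.*-congˡ (R.trans (R.*-congʳ E[F]≈0) (R.zeroˡ _))) ⟩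
    linearizedAt c⟨ w ⟩ F (suc d) ⊕ constant (p ∸ 1) ⊛ zeroS       ≈⟨ R.+-congˡ (R.zeroʳ _) ⟩
    linearizedAt c⟨ w ⟩ F (suc d) ⊕ zeroS                          ≈⟨ R.+-identityʳ _ ⟩
    linearizedAt c⟨ w ⟩ F (suc d)                                  ∎

  linearizedAt-root : ∀ w w' → coefficients w ≗ coefficients w' → ∀ {f} → IsRoot E f →
    linearizedAt c⟨ w ⟩ (liftS f) (suc d) ≈ₛ linearizedAt c⟨ w' ⟩ (liftS f) (suc d)
  linearizedAt-root w w' same {f} f-root = begin
    linearizedAt c⟨ w ⟩ (liftS f) (suc d)    ≈⟨ eval-T w (root⇒eval≈0 f-root) ⟨
    eval T⟨ w ⟩ (liftS f)                   ≈⟨ eval-cong-rows T⟨ w ⟩ T⟨ w' ⟩ (liftS f) (coefficients-rows w w' same) ⟩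
    eval T⟨ w' ⟩ (liftS f)                  ≈⟨ eval-T w' (root⇒eval≈0 f-root) ⟩
    linearizedAt c⟨ w' ⟩ (liftS f) (suc d)   ∎

  choice-ext : ∀ w w' → (∀ i → i < suc d → c⟨ w ⟩ i ≈ₛ c⟨ w' ⟩ i) → (∀ l → row Q⟨ w ⟩ l ≈ₛ row Q⟨ w' ⟩ l) → w ≗ w'
  choice-ext w w' c≈c' Q≈Q' k with splitAt #c k | join-splitAt #c #Q k
  ... | inj₁ i | join≡k = subst (λ x → w x ≡ w' x) join≡k
    (subst (λ x → w (x ↑ˡ #Q) ≡ w' (x ↑ˡ #Q)) (combine-remQuot {suc d} (suc D) i) (c-entry (remQuot (suc D) i)))
    where
    c-entry : ∀ ((i , a) : Fin (suc d) × Fin (suc D)) → w (combine i a ↑ˡ #Q) ≡ w' (combine i a ↑ˡ #Q)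
    c-entry (i , a) = toℕ-injectiveₚ (subst₂ (λ u v → u % p ≡ v % p) (c⟨⟩-at w i a) (c⟨⟩-at w' i a) (at (c≈c' (toℕ i) (toℕ<n i)) (toℕ a)))
  ... | inj₂ j | join≡k = subst (λ x → w x ≡ w' x) join≡k
    (subst (λ x → w (#c ↑ʳ x) ≡ w' (#c ↑ʳ x)) (combine-remQuot {suc δQ} (suc DQ) j) (Q-entry (remQuot (suc DQ) j)))
    where
    Q-entry : ∀ ((l , a) : Fin (suc δQ) × Fin (suc DQ)) → w (#c ↑ʳ combine l a) ≡ w' (#c ↑ʳ combine l a)
    Q-entry (l , a) = toℕ-injectiveₚ (subst₂ (λ u v → u % p ≡ v % p) (Q⟨⟩-at w l a) (Q⟨⟩-at w' l a) (at (Q≈Q' (toℕ l)) (toℕ a)))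

  p-1≢ₚ0 : ¬ (p ∸ 1 ≡ₚ 0)
  p-1≢ₚ0 p-1≡0 = >⇒≢ (∸-monoˡ-≤ 1 (prime>1 pp)) (trans (sym (m<n⇒m%n≡m p-1<p)) (trans p-1≡0 0%p≡0))
    where p-1<p : p ∸ 1 < p
          p-1<p = ∸-monoʳ-< {p} {1} {0} z<s (<⇒≤ (prime>1 pp))

  #T<#c+#Q : #T < #c + #Q
  #T<#c+#Q = ≤-reflexive (trans (cong (λ z → suc (suc D * suc z)) (sym (m∸n+n≡m (<⇒≤ (n<b^n (prime>1 pp) d))))) (count δQ d m))
    where count : ∀ (x y z : ℕ) → suc (suc ((x + 1) * z) * suc (x + y)) ≡ suc y * suc ((x + 1) * z) + suc x * suc (x * z)
          count = solve-∀

  module _ {w w'} (same : coefficients w ≗ coefficients w') where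

    linearizedAt-difference : ∀ {f g} → IsRoot E f → IsRoot E g →
      linearizedAt c⟨ w ⟩ (difference f g) (suc d) ≈ₛ linearizedAt c⟨ w' ⟩ (difference f g) (suc d)
    linearizedAt-difference {f} {g} f-root g-root = ⊕-cancelˡ
      (R.trans (R.sym (linearizedAt-additive c⟨ w ⟩ (suc d) f≈g+h))
               (R.trans (linearizedAt-root w w' same f-root) (linearizedAt-additive c⟨ w' ⟩ (suc d) f≈g+h)))
      (linearizedAt-root w w' same g-root)
      where
      f≈g+h : liftS f ≈ₛ liftS g ⊕ difference f g
      f≈g+h = liftS≈liftS⊕difference f g

    Q-determined : (∀ i → i < suc d → c⟨ w ⟩ i ≈ₛ c⟨ w' ⟩ i) → ∀ l → row Q⟨ w ⟩ l ≈ₛ row Q⟨ w' ⟩ l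
    Q-determined c≈c' = *ʸ-cancelˡ d δQ Eʸ Eʸ-degY (proj₂ Eʸ-leading) (Q-degY w) (Q-degY w')
      λ j → ⊛-cancelˡ ((λ _ ()) , p-1≢ₚ0) (begin
        constant (p ∸ 1) ⊛ row (Eʸ *ʸ Q⟨ w ⟩) j     ≈⟨ row-·ʸ (constant (p ∸ 1)) (Eʸ *ʸ Q⟨ w ⟩) j ⟨
        row (constant (p ∸ 1) ·ʸ (Eʸ *ʸ Q⟨ w ⟩)) j   ≈⟨ ⊕-cancelˡ (T-rows j) (row-linearized-cong (suc d) c≈c' j) ⟩
        row (constant (p ∸ 1) ·ʸ (Eʸ *ʸ Q⟨ w' ⟩)) j  ≈⟨ row-·ʸ (constant (p ∸ 1)) (Eʸ *ʸ Q⟨ w' ⟩) j ⟩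
        constant (p ∸ 1) ⊛ row (Eʸ *ʸ Q⟨ w' ⟩) j    ∎)
      where
      T-rows : ∀ j → row (linearized c⟨ w ⟩ (suc d)) j ⊕ row (constant (p ∸ 1) ·ʸ (Eʸ *ʸ Q⟨ w ⟩)) j
                  ≈ₛ row (linearized c⟨ w' ⟩ (suc d)) j ⊕ row (constant (p ∸ 1) ·ʸ (Eʸ *ʸ Q⟨ w' ⟩)) j
      T-rows j = R.trans (R.sym (row-+ʸ (linearized c⟨ w ⟩ (suc d)) _ j))
                         (R.trans (coefficients-rows w w' same j) (row-+ʸ (linearized c⟨ w' ⟩ (suc d)) _ j))

  decode : Fin (p ^ (#c + #Q)) → Choice
  decode = finToFun

  module _ {f g} (f-root : IsRoot E f) (g-root : IsRoot E g) {n} (D<n : D < n) (h-order : HasOrder (difference f g) n) where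

    coefficients-injective : ∀ w w' → coefficients w ≗ coefficients w' → w ≗ w'
    coefficients-injective w w' same = choice-ext w w' c≈c' (Q-determined {w} {w'} same c≈c')
      where
      c≈c' : ∀ i → i < suc d → c⟨ w ⟩ i ≈ₛ c⟨ w' ⟩ i
      c≈c' = linearizedAt-injective h-order (suc d) D<n (c-degX w) (c-degX w') (linearizedAt-difference {w} {w'} same f-root g-root)

    -- There are p^(#c + #Q) choices but only p^#T possible coefficient tables, and #T < #c + #Q.
    contradiction-by-counting : ⊥
    contradiction-by-counting with pigeonhole (^-monoʳ-< p (prime>1 pp) #T<#c+#Q) (funToFin ∘ coefficients ∘ decode)
    ... | x , y , x<y , same = <⇒≢ x<y (cong toℕ (begin-≡
      x                      ≡⟨ funToFin-finToFin {#c + #Q} {p} x ⟨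
      funToFin (decode x)    ≡⟨ funToFin-cong (coefficients-injective (decode x) (decode y) same-coefficients) ⟩
      funToFin (decode y)    ≡⟨ funToFin-finToFin {#c + #Q} {p} y ⟩
      y                      ∎-≡))
      where
      open ≡-Reasoning renaming (begin_ to begin-≡_; _∎ to _∎-≡)
      same-coefficients : coefficients (decode x) ≗ coefficients (decode y)
      same-coefficients k = trans (sym (finToFun-funToFin (coefficients (decode x)) k))
                           (trans (cong (λ z → finToFun z k) same) (finToFun-funToFin (coefficients (decode y)) k))

  differ-within-D : ∀ {f g} → IsRoot E f → IsRoot E g → ¬ (∀ n → f n ≡ g n) → ∃[ n ] (n ≤ D × f n ≢ g n)
  differ-within-D {f} {g} f-root g-root f≢g with all? (λ (i : Fin (suc D)) → f (toℕ i) Fin.≟ g (toℕ i))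
  ... | no ¬agree = let i , fᵢ≢gᵢ = ¬∀⟶∃¬ (suc D) _ (λ i → f (toℕ i) Fin.≟ g (toℕ i)) ¬agree
                    in  toℕ i , s≤s⁻¹ (toℕ<n i) , fᵢ≢gᵢ
  ... | yes agree = ⊥-elim (f≢g (<-rec _ step))
    where
    step : ∀ n → (∀ {k} → k < n → f k ≡ g k) → f n ≡ g n
    step n agree-below with n ≤? D
    ... | yes n≤D = subst (λ k → f k ≡ g k) (toℕ-fromℕ< (s≤s n≤D)) (agree (fromℕ< (s≤s n≤D)))
    ... | no n≰D with f n Fin.≟ g n
    ...   | yes fₙ≡gₙ = fₙ≡gₙ
    ...   | no fₙ≢gₙ  = ⊥-elim (contradiction-by-counting f-root g-root (≰⇒> n≰D)
                          ((λ k k<n → difference≡0 f g k (agree-below k<n)) , difference≢0 f g n fₙ≢gₙ))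

corollaryG : (p : ℕ) → Prime p → (E : Poly2 p) → NonZeroPoly E →
    (d m : ℕ) → DegY E d → DegX E m →
    (f g : ℕ → Fin p) → ¬ (∀ n → f n ≡ g n) → IsRoot E f → IsRoot E g →
    ∃[ n ] (n ≤ (d + 1) * (p ^ d ∸ d + 1) * m × f n ≢ g n)
corollaryG p pp E _ d m E-degY E-degX f g f≢g f-root g-root =
  let n , n≤D , fₙ≢gₙ = differ-within-D f-root g-root f≢g
  in  n , ≤-trans n≤D D≤bound , fₙ≢gₙ
  where
  open Counting p pp E d m E-degY E-degX using (D; differ-within-D)
  D≤bound : D ≤ (d + 1) * (p ^ d ∸ d + 1) * m
  D≤bound = begin
    D                              ≤⟨ m≤n*m D (suc d) ⟩
    suc d * D                      ≡⟨ cong (_* D) (+-comm 1 d) ⟩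
    (d + 1) * D                    ≡⟨ *-assoc (d + 1) (p ^ d ∸ d + 1) m ⟨
    (d + 1) * (p ^ d ∸ d + 1) * m  ∎
    where open ≤-Reasoning
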